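{- Every symmetric Boolean function on $n$ variables has a depth-three circuit of the form $\text{MOD}_5 \circ \text{MOD}_6 \circ \text{MOD}_5$ of size $\exp(O(n^{1/3}\log n))$. Furthermore, the circuit can be chosen so that on every input, the sum of the inputs to the output gate is always congruent to either $0$ or $1$ modulo $5$.
   Context: A Boolean function is symmetric if its value depends only on the number of ones in the input. A $\text{MOD}_m$ gate has unbounded fan-in and outputs $1$ iff the sum of its Boolean inputs (counted with wire multiplicity) is divisible by $m$. $G_1\circ G_2\circ G_3$ denotes a depth-3 circuit with output gate of type $G_1$, middle layer of gates of type $G_2$, and bottom layer (adjacent to the inputs) of gates of type $G_3$. Size is the number of gates. -}

module Defs where

open import Data.Nat using (ℕ; zero; suc; _+_; _*_; _%_; _≡ᵇ_)
open import Data.Fin using (Fin; zero; suc)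
open import Data.Bool using (Bool; true; false)
open import Relation.Binary.PropositionalEquality using (_≡_)

sumFin : ∀ {n} → (Fin n → ℕ) → ℕ
sumFin {zero}  f = 0
sumFin {suc n} f = f zero + sumFin (λ i → f (suc i))

b2n : Bool → ℕ
b2n true  = 1
b2n false = 0

weight : ∀ {n} → (Fin n → Bool) → ℕ
weight x = sumFin (λ i → b2n (x i))

Symmetric : ∀ {n} → ((Fin n → Bool) → Bool) → Set
Symmetric {n} f = (x y : Fin n → Bool) → weight x ≡ weight y → f x ≡ f y

modGate : (m : ℕ) .{{_ : Data.Nat.NonZero m}} → ℕ → Bool
modGate m s = (s % m) ≡ᵇ 0

-- A layered depth-3 circuit MOD_5 ∘ MOD_6 ∘ MOD_5 on n inputs.
-- 'mid' middle gates, 'bot' bottom gates; wires carry multiplicities (ℕ, 0 = no wire).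
record Circuit (n : ℕ) : Set where
  field
    mid  : ℕ
    bot  : ℕ
    wBot : Fin bot → Fin n → ℕ
    wMid : Fin mid → Fin bot → ℕ
    wTop : Fin mid → ℕ

  size : ℕ
  size = 1 + mid + bot

  botVal : (Fin n → Bool) → Fin bot → Bool
  botVal x j = modGate 5 (sumFin (λ i → wBot j i * b2n (x i)))

  midVal : (Fin n → Bool) → Fin mid → Bool
  midVal x k = modGate 6 (sumFin (λ j → wMid k j * b2n (botVal x j)))

  topSum : (Fin n → Bool) → ℕ
  topSum x = sumFin (λ k → wTop k * b2n (midVal x k))

  eval : (Fin n → Bool) → Bool
  eval x = modGate 5 (topSum x)

-- A symmetric function is a function F of the weight w ≤ n of its input. Pick q₂ = 2^e₂, q₃ = 3^e₃ and
-- q₅ = 5^e₅ of size O(n^{1/3}) with product above n; by the Chinese remainder theorem w is then the only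
-- t ≤ n congruent to w modulo all three. As w C j mod p only depends on w mod p^e when j < p^e, the
-- indicator [w ≡ t mod q_p] agrees modulo p with a symmetric polynomial of degree below q_p. Modulo 2
-- and modulo 3 a monomial of degree d is a weighted sum of O(3^d) MOD₅ gates: summing the MOD₅ gates of
-- ∑ aᵢ xᵢ over all choices of the coefficients aᵢ ∈ {0,…,p-1}, an input xᵢ = 0 contributes p equal copies,
-- and a normalising weight fixes the value at xᵢ = 1. A MOD₆ gate fed 3(a + 1) + 2(b + 2) is the
-- conjunction of a ≡ 1 mod 2 and b ≡ 1 mod 3. The output MOD₅ gate sums, over t ≤ n and the terms of the
-- mod-5 indicator of t, middle gates computing such a term times the mod-2 and mod-3 indicators of t,
-- with weight 0 if F t holds and 1 otherwise; its input is thus ≡ [F w fails] mod 5. All gate counts are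
-- n^{O(q)} = exp(O(n^{1/3} log n)).

module Submission where

open import Defs
open import Data.Bool using (Bool; true; false; _∧_; not; if_then_else_; T)
open import Data.Bool.ListAction using (and; all)
open import Data.Bool.Properties using (∧-assoc) renaming (_≟_ to _≟ᵇ_)
open import Data.Fin using (Fin; zero; suc; toℕ; fromℕ<; #_)
open import Data.Fin.Properties using (toℕ-fromℕ<; all?)
open import Data.List using (List; []; _∷_; _++_; map; concatMap; length; lookup; replicate; upTo)
open import Data.List.Properties using (length-++; length-map; map-∘; length-replicate; length-upTo; upTo-∷ʳ)
open import Data.List.Relation.Unary.All as All using (All; []; _∷_)
import Data.List.Relation.Unary.All.Properties as All
open import Data.Nat
open import Data.Nat.Combinatorics using (_C_; nCk+nC[k+1]≡[n+1]C[k+1]; k>n⇒nCk≡0; nCn≡1; nC1≡n)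
open import Data.Nat.Coprimality using (Coprime; coprime?; coprime-divisor)
import Data.Nat.Coprimality as Coprime
open import Data.Nat.Divisibility
open import Data.Nat.DivMod
open import Data.Nat.Primality using (Prime; prime?; prime[2]; prime⇒irreducible; prime⇒nonZero)
open import Data.Nat.Properties
open import Algebra.Properties.CommutativeSemigroup *-commutativeSemigroup using (x∙yz≈y∙xz)
open import Algebra.Properties.CommutativeSemigroup +-commutativeSemigroup using (interchange)
open import Data.Nat.Tactic.RingSolver using (solve-∀)
open import Data.Product using (Σ; _×_; _,_; proj₁; proj₂)
open import Data.Sum using (_⊎_; inj₁; inj₂)
open import Data.Vec as Vec using (Vec; tabulate; _∷_; [])
open import Data.Vec.Properties using (lookup∘tabulate; tabulate-cong)
open import Function using (_∘_)
open import Level using (0ℓ)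
open import Relation.Binary.Bundles using (Setoid)
open import Relation.Binary.PropositionalEquality
  using (_≡_; _≢_; ≢-sym; refl; sym; trans; cong; cong₂; subst; module ≡-Reasoning)
import Relation.Binary.Reasoning.Setoid as SetoidReasoning
open import Relation.Nullary using (¬_; Dec; yes; no; contradiction)
open import Relation.Nullary.Decidable using (from-yes; dec-true; dec-false)

private
  variable
    A B : Set
    m n : ℕ

sumBy : (A → ℕ) → List A → ℕ
sumBy f []       = 0
sumBy f (x ∷ xs) = f x + sumBy f xs

sumBy-++ : (f : A → ℕ) (xs ys : List A) → sumBy f (xs ++ ys) ≡ sumBy f xs + sumBy f ys
sumBy-++ f []       ys = refl
sumBy-++ f (x ∷ xs) ys = trans (cong (f x +_) (sumBy-++ f xs ys)) (sym (+-assoc (f x) _ _))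

sumBy-map : (f : B → ℕ) (g : A → B) (xs : List A) → sumBy f (map g xs) ≡ sumBy (f ∘ g) xs
sumBy-map f g []       = refl
sumBy-map f g (x ∷ xs) = cong (f (g x) +_) (sumBy-map f g xs)

sumBy-cong : {f g : A → ℕ} (xs : List A) → (∀ a → f a ≡ g a) → sumBy f xs ≡ sumBy g xs
sumBy-cong []       f≗g = refl
sumBy-cong (x ∷ xs) f≗g = cong₂ _+_ (f≗g x) (sumBy-cong xs f≗g)

sumBy-*ˡ : (c : ℕ) (f : A → ℕ) (xs : List A) → sumBy (λ a → c * f a) xs ≡ c * sumBy f xs
sumBy-*ˡ c f []       = sym (*-zeroʳ c)
sumBy-*ˡ c f (x ∷ xs) = trans (cong (c * f x +_) (sumBy-*ˡ c f xs)) (sym (*-distribˡ-+ c (f x) _))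

sumBy-const : (c : ℕ) (xs : List A) → sumBy (λ _ → c) xs ≡ length xs * c
sumBy-const c []       = refl
sumBy-const c (x ∷ xs) = cong (c +_) (sumBy-const c xs)

sumBy-replicate : (f : A → ℕ) (k : ℕ) (a : A) → sumBy f (replicate k a) ≡ k * f a
sumBy-replicate f zero    a = refl
sumBy-replicate f (suc k) a = cong (f a +_) (sumBy-replicate f k a)

sumBy-concatMap : (f : B → ℕ) (g : A → List B) (xs : List A) →
                  sumBy f (concatMap g xs) ≡ sumBy (sumBy f ∘ g) xs
sumBy-concatMap f g []       = refl
sumBy-concatMap f g (x ∷ xs) =
  trans (sumBy-++ f (g x) _) (cong (sumBy f (g x) +_) (sumBy-concatMap f g xs))

length-concatMap : (g : A → List B) (xs : List A) → length (concatMap g xs) ≡ sumBy (length ∘ g) xs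
length-concatMap g []       = refl
length-concatMap g (x ∷ xs) = trans (length-++ (g x)) (cong (length (g x) +_) (length-concatMap g xs))

sumBy-≤ : {f : A → ℕ} {c : ℕ} {xs : List A} → All (λ a → f a ≤ c) xs → sumBy f xs ≤ length xs * c
sumBy-≤ []           = z≤n
sumBy-≤ (fx≤c ∷ f≤c) = +-mono-≤ fx≤c (sumBy-≤ f≤c)

sumBy-upTo-zero : ∀ {f : ℕ → ℕ} m → (∀ t → t < m → f t ≡ 0) → sumBy f (upTo m) ≡ 0
sumBy-upTo-zero {f} zero    f≡0 = refl
sumBy-upTo-zero {f} (suc m) f≡0 = begin
  sumBy f (upTo (suc m))          ≡⟨ cong (sumBy f) (upTo-∷ʳ m) ⟨
  sumBy f (upTo m ++ m ∷ [])      ≡⟨ sumBy-++ f (upTo m) (m ∷ []) ⟩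
  sumBy f (upTo m) + (f m + 0)    ≡⟨ cong₂ (λ a b → a + (b + 0)) (sumBy-upTo-zero m (λ t t<m → f≡0 t (m<n⇒m<1+n t<m)))
                                                                  (f≡0 m (n<1+n m)) ⟩
  0                               ∎
  where open ≡-Reasoning

sumBy-upTo-single : ∀ {f : ℕ → ℕ} {w} m → w < m → (∀ t → t < m → t ≢ w → f t ≡ 0) → sumBy f (upTo m) ≡ f w
sumBy-upTo-single {f} {w} (suc m) w<1+m f≡0 = begin
  sumBy f (upTo (suc m))          ≡⟨ cong (sumBy f) (upTo-∷ʳ m) ⟨
  sumBy f (upTo m ++ m ∷ [])      ≡⟨ sumBy-++ f (upTo m) (m ∷ []) ⟩
  sumBy f (upTo m) + (f m + 0)    ≡⟨ cong (sumBy f (upTo m) +_) (+-identityʳ (f m)) ⟩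
  sumBy f (upTo m) + f m          ≡⟨ last (m≤n⇒m<n∨m≡n (s≤s⁻¹ w<1+m)) ⟩
  f w                             ∎
  where
  open ≡-Reasoning
  last : w < m ⊎ w ≡ m → sumBy f (upTo m) + f m ≡ f w
  last (inj₁ w<m)  = trans (cong₂ _+_ (sumBy-upTo-single m w<m (λ t t<m → f≡0 t (m<n⇒m<1+n t<m)))
                                     (f≡0 m (n<1+n m) (≢-sym (<⇒≢ w<m))))
                           (+-identityʳ (f w))
  last (inj₂ refl) = cong (_+ f w) (sumBy-upTo-zero m (λ t t<m → f≡0 t (m<n⇒m<1+n t<m) (<⇒≢ t<m)))

sumFin-cong : ∀ {n} {f g : Fin n → ℕ} → (∀ i → f i ≡ g i) → sumFin f ≡ sumFin g
sumFin-cong {zero}  f≗g = refl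
sumFin-cong {suc n} f≗g = cong₂ _+_ (f≗g zero) (sumFin-cong (f≗g ∘ suc))

sumFin-lookup : (f : A → ℕ) (xs : List A) → sumFin (f ∘ lookup xs) ≡ sumBy f xs
sumFin-lookup f []       = refl
sumFin-lookup f (x ∷ xs) = cong (f x +_) (sumFin-lookup f xs)

sumFin-+ : (f g : Fin n → ℕ) → sumFin (λ k → f k + g k) ≡ sumFin f + sumFin g
sumFin-+ {zero}  f g = refl
sumFin-+ {suc n} f g =
  trans (cong (f zero + g zero +_) (sumFin-+ (f ∘ suc) (g ∘ suc))) (interchange (f zero) (g zero) _ _)

b2n-∧ : ∀ a b → b2n (a ∧ b) ≡ b2n a * b2n b
b2n-∧ true  b = sym (+-identityʳ (b2n b))
b2n-∧ false b = refl

b2n≤1 : ∀ b → b2n b ≤ 1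
b2n≤1 true  = s≤s z≤n
b2n≤1 false = z≤n

≡ᵇ-refl : ∀ k → (k ≡ᵇ k) ≡ true
≡ᵇ-refl k = dec-true (k ≟ k) refl

≢⇒≡ᵇ-false : ∀ {k l} → k ≢ l → (k ≡ᵇ l) ≡ false
≢⇒≡ᵇ-false {k} {l} k≢l = dec-false (k ≟ l) k≢l

≡ᵇ-true⇒≡ : ∀ {k l} → (k ≡ᵇ l) ≡ true → k ≡ l
≡ᵇ-true⇒≡ {k} {l} eq = ≡ᵇ⇒≡ k l (subst T (sym eq) _)

-- Congruence modulo m

infix 4 _≡_[mod_]
record _≡_[mod_] (a b m : ℕ) .{{_ : NonZero m}} : Set where
  constructor mod-≡
  field %-≡ : a % m ≡ b % m
open _≡_[mod_] public

module _ {m : ℕ} .{{_ : NonZero m}} where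

  ≡⇒≡-mod : ∀ {a b} → a ≡ b → a ≡ b [mod m ]
  ≡⇒≡-mod refl = mod-≡ refl

  ≡-mod-refl : ∀ {a} → a ≡ a [mod m ]
  ≡-mod-refl = mod-≡ refl

  ≡-mod-sym : ∀ {a b} → a ≡ b [mod m ] → b ≡ a [mod m ]
  ≡-mod-sym (mod-≡ a≡b) = mod-≡ (sym a≡b)

  ≡-mod-trans : ∀ {a b c} → a ≡ b [mod m ] → b ≡ c [mod m ] → a ≡ c [mod m ]
  ≡-mod-trans (mod-≡ a≡b) (mod-≡ b≡c) = mod-≡ (trans a≡b b≡c)

  modSetoid : Setoid 0ℓ 0ℓ
  modSetoid = record
    { Carrier       = ℕ
    ; _≈_           = _≡_[mod m ]
    ; isEquivalence = record
      { refl  = ≡-mod-refl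
      ; sym   = ≡-mod-sym
      ; trans = ≡-mod-trans
      }
    }

  module ≡-mod-Reasoning = SetoidReasoning modSetoid

  m≡0-mod : m ≡ 0 [mod m ]
  m≡0-mod = mod-≡ (trans (n%n≡0 m) (sym (m<n⇒m%n≡m (>-nonZero⁻¹ m))))

  %-≡-mod : ∀ a → a % m ≡ a [mod m ]
  %-≡-mod a = mod-≡ (m%n%n≡m%n a m)

  +-cong-mod : ∀ {a b c d} → a ≡ b [mod m ] → c ≡ d [mod m ] → a + c ≡ b + d [mod m ]
  +-cong-mod {a} {b} {c} {d} (mod-≡ a≡b) (mod-≡ c≡d) = mod-≡ (begin
    (a + c) % m             ≡⟨ %-distribˡ-+ a c m ⟩
    (a % m + c % m) % m     ≡⟨ cong₂ (λ u v → (u + v) % m) a≡b c≡d ⟩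
    (b % m + d % m) % m     ≡⟨ %-distribˡ-+ b d m ⟨
    (b + d) % m             ∎)
    where open ≡-Reasoning

  *-cong-mod : ∀ {a b c d} → a ≡ b [mod m ] → c ≡ d [mod m ] → a * c ≡ b * d [mod m ]
  *-cong-mod {a} {b} {c} {d} (mod-≡ a≡b) (mod-≡ c≡d) = mod-≡ (begin
    (a * c) % m             ≡⟨ %-distribˡ-* a c m ⟩
    (a % m * (c % m)) % m   ≡⟨ cong₂ (λ u v → (u * v) % m) a≡b c≡d ⟩
    (b % m * (d % m)) % m   ≡⟨ %-distribˡ-* b d m ⟨
    (b * d) % m             ∎)
    where open ≡-Reasoning

  *-congˡ-mod : ∀ c {a b} → a ≡ b [mod m ] → c * a ≡ c * b [mod m ]
  *-congˡ-mod c = *-cong-mod (≡-mod-refl {c})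

  sumBy-cong-mod : {f g : A → ℕ} (xs : List A) → (∀ a → f a ≡ g a [mod m ]) →
                   sumBy f xs ≡ sumBy g xs [mod m ]
  sumBy-cong-mod []       f≡g = ≡-mod-refl
  sumBy-cong-mod (x ∷ xs) f≡g = +-cong-mod (f≡g x) (sumBy-cong-mod xs f≡g)

*-cong-mod-scale : ∀ {a c} m k .{{_ : NonZero m}} .{{_ : NonZero (m * k)}} →
                   a ≡ c [mod m ] → k * a ≡ k * c [mod m * k ]
*-cong-mod-scale {a} {c} m k (mod-≡ a≡c) = mod-≡ (begin
  k * a % (m * k)   ≡⟨ cong (_% (m * k)) (*-comm k a) ⟩
  a * k % (m * k)   ≡⟨ m%n*o≡m*o%[n*o] a m k ⟨
  a % m * k         ≡⟨ cong (_* k) a≡c ⟩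
  c % m * k         ≡⟨ m%n*o≡m*o%[n*o] c m k ⟩
  c * k % (m * k)   ≡⟨ cong (_% (m * k)) (*-comm c k) ⟩
  k * c % (m * k)   ∎)
  where open ≡-Reasoning

-- Coprimality and the Chinese remainder theorem

prime∤⇒coprime : ∀ {p} → Prime p → ¬ p ∣ n → Coprime p n
prime∤⇒coprime p-prime p∤n (d∣p , d∣n) with prime⇒irreducible p-prime d∣p
... | inj₁ d≡1 = d≡1
... | inj₂ refl = contradiction d∣n p∤n

coprime-*ʳ : ∀ {o} → Coprime m n → Coprime m o → Coprime m (n * o)
coprime-*ʳ m⊥n m⊥o (d∣m , d∣n*o) = m⊥o (d∣m , coprime-divisor d⊥n d∣n*o)
  where
  d⊥n : Coprime _ _
  d⊥n (e∣d , e∣n) = m⊥n (∣-trans e∣d d∣m , e∣n)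

coprime-^ʳ : Coprime m n → ∀ k → Coprime m (n ^ k)
coprime-^ʳ m⊥n zero    (_ , d∣1) = ∣1⇒≡1 d∣1
coprime-^ʳ m⊥n (suc k) = coprime-*ʳ m⊥n (coprime-^ʳ m⊥n k)

coprime-^ˡ : Coprime m n → ∀ j → Coprime (m ^ j) n
coprime-^ˡ m⊥n j = Coprime.sym (coprime-^ʳ (Coprime.sym m⊥n) j)

coprime-^ : Coprime m n → ∀ j k → Coprime (m ^ j) (n ^ k)
coprime-^ m⊥n j k = coprime-^ˡ (coprime-^ʳ m⊥n k) j

module _ {m : ℕ} .{{_ : NonZero m}} where

  ≡-mod⇒∣∸ : ∀ {w t} → w ≤ t → w ≡ t [mod m ] → m ∣ t ∸ w
  ≡-mod⇒∣∸ {w} {t} w≤t (mod-≡ w≡t) = divides (t / m ∸ w / m) (begin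
    t ∸ w                                    ≡⟨ cong₂ _∸_ (m≡m%n+[m/n]*n t m) (m≡m%n+[m/n]*n w m) ⟩
    (t % m + t / m * m) ∸ (w % m + w / m * m) ≡⟨ cong (λ r → (t % m + t / m * m) ∸ (r + w / m * m)) w≡t ⟩
    (t % m + t / m * m) ∸ (t % m + w / m * m) ≡⟨ [m+n]∸[m+o]≡n∸o (t % m) _ _ ⟩
    t / m * m ∸ w / m * m                     ≡⟨ *-distribʳ-∸ m (t / m) (w / m) ⟨
    (t / m ∸ w / m) * m                       ∎)
    where open ≡-Reasoning

  ∣∸⇒≡-mod : ∀ {w t} → w ≤ t → m ∣ t ∸ w → w ≡ t [mod m ]
  ∣∸⇒≡-mod {w} {t} w≤t (divides k t∸w≡km) = mod-≡ (begin
    w % m                ≡⟨ [m+kn]%n≡m%n w k m ⟨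
    (w + k * m) % m      ≡⟨ cong (λ d → (w + d) % m) t∸w≡km ⟨
    (w + (t ∸ w)) % m    ≡⟨ cong (_% m) (m+[n∸m]≡n w≤t) ⟩
    t % m                ∎)
    where open ≡-Reasoning

  <-≡-mod⇒≡ : ∀ {w t} → w < m → t < m → w ≡ t [mod m ] → w ≡ t
  <-≡-mod⇒≡ w<m t<m (mod-≡ w≡t) = trans (sym (m<n⇒m%n≡m w<m)) (trans w≡t (m<n⇒m%n≡m t<m))

coprime⇒*∣ : ∀ {a b d} → Coprime a b → a ∣ d → b ∣ d → a * b ∣ d
coprime⇒*∣ {a} {b} a⊥b (divides k refl) b∣k*a
  with coprime-divisor (Coprime.sym a⊥b) (subst (b ∣_) (*-comm k a) b∣k*a)
... | divides l refl = divides l (trans (*-assoc l b a) (cong (l *_) (*-comm b a)))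

module _ {a b : ℕ} .{{_ : NonZero a}} .{{_ : NonZero b}} where

  private instance
    a*b≢0 : NonZero (a * b)
    a*b≢0 = m*n≢0 a b

  coprime-≡-mod : ∀ {w t} → Coprime a b → w ≡ t [mod a ] → w ≡ t [mod b ] → w ≡ t [mod a * b ]
  coprime-≡-mod {w} {t} a⊥b w≡t[a] w≡t[b] with ≤-total w t
  ... | inj₁ w≤t = ∣∸⇒≡-mod w≤t (coprime⇒*∣ a⊥b (≡-mod⇒∣∸ w≤t w≡t[a]) (≡-mod⇒∣∸ w≤t w≡t[b]))
  ... | inj₂ t≤w = ≡-mod-sym (∣∸⇒≡-mod t≤w (coprime⇒*∣ a⊥b (≡-mod⇒∣∸ t≤w (≡-mod-sym w≡t[a]))
                                                            (≡-mod⇒∣∸ t≤w (≡-mod-sym w≡t[b]))))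

-- Binomial coefficients

C-absorption : ∀ n k → suc k * (suc n C suc k) ≡ suc n * (n C k)
C-absorption n zero = begin
  1 * (suc n C 1)  ≡⟨ *-identityˡ _ ⟩
  suc n C 1        ≡⟨ nC1≡n (suc n) ⟩
  suc n            ≡⟨ *-identityʳ (suc n) ⟨
  suc n * 1        ∎
  where open ≡-Reasoning
C-absorption zero (suc k) =
  trans (cong (suc (suc k) *_) (k>n⇒nCk≡0 (s≤s (s≤s (z≤n {k}))))) (*-zeroʳ (suc (suc k)))
C-absorption (suc n) (suc k) = begin
  suc (suc k) * (suc (suc n) C suc (suc k))
    ≡⟨ cong (suc (suc k) *_) (nCk+nC[k+1]≡[n+1]C[k+1] (suc n) (suc k)) ⟨
  suc (suc k) * (X + suc n C suc (suc k))
    ≡⟨ *-distribˡ-+ (suc (suc k)) X _ ⟩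
  (X + suc k * X) + suc (suc k) * (suc n C suc (suc k))
    ≡⟨ cong₂ (λ a b → (X + a) + b) (C-absorption n k) (C-absorption n (suc k)) ⟩
  (X + suc n * (n C k)) + suc n * (n C suc k)
    ≡⟨ +-assoc X _ _ ⟩
  X + (suc n * (n C k) + suc n * (n C suc k))
    ≡⟨ cong (X +_) (*-distribˡ-+ (suc n) (n C k) _) ⟨
  X + suc n * (n C k + n C suc k)
    ≡⟨ cong (λ a → X + suc n * a) (nCk+nC[k+1]≡[n+1]C[k+1] n k) ⟩
  suc (suc n) * X
    ∎
  where
  open ≡-Reasoning
  X : ℕ
  X = suc n C suc k

n∣nC[1+k]*[1+k] : ∀ n k → n ∣ (n C suc k) * suc k
n∣nC[1+k]*[1+k] zero    k = divides 0 refl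
n∣nC[1+k]*[1+k] (suc n) k =
  divides (n C k) (trans (*-comm (suc n C suc k) (suc k)) (trans (C-absorption n k) (*-comm (suc n) _)))

binomialSum : ℕ → ℕ → List ℕ → ℕ
binomialSum w j []       = 0
binomialSum w j (c ∷ cs) = c * (w C j) + binomialSum w (suc j) cs

binomialSum-snoc : ∀ w j cs c →
  binomialSum w j (cs ++ c ∷ []) ≡ binomialSum w j cs + c * (w C (j + length cs))
binomialSum-snoc w j []       c =
  trans (+-identityʳ _) (cong (λ i → c * (w C i)) (sym (+-identityʳ j)))
binomialSum-snoc w j (d ∷ cs) c = begin
  d * (w C j) + binomialSum w (suc j) (cs ++ c ∷ [])
    ≡⟨ cong (d * (w C j) +_) (binomialSum-snoc w (suc j) cs c) ⟩
  d * (w C j) + (binomialSum w (suc j) cs + c * (w C (suc j + length cs)))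
    ≡⟨ +-assoc (d * (w C j)) _ _ ⟨
  d * (w C j) + binomialSum w (suc j) cs + c * (w C (suc j + length cs))
    ≡⟨ cong (λ i → d * (w C j) + binomialSum w (suc j) cs + c * (w C i)) (+-suc j (length cs)) ⟨
  d * (w C j) + binomialSum w (suc j) cs + c * (w C (j + suc (length cs)))
    ∎
  where open ≡-Reasoning

module _ (p : ℕ) .{{_ : NonZero p}} where

  open ≡-mod-Reasoning {p}

  -- Each new coefficient corrects the value at the next point; (p ∸ 1) * S stands for -S mod p.
  interpolate : (ℕ → ℕ) → ℕ → List ℕ
  interpolate g zero    = []
  interpolate g (suc m) = cs ++ (g m + (p ∸ 1) * binomialSum m 0 cs) ∷ []
    where cs = interpolate g m

  length-interpolate : ∀ g m → length (interpolate g m) ≡ m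
  length-interpolate g zero    = refl
  length-interpolate g (suc m) =
    trans (length-++ (interpolate g m)) (trans (+-comm _ 1) (cong suc (length-interpolate g m)))

  interpolate-correct : ∀ g m w → w < m → binomialSum w 0 (interpolate g m) ≡ g w [mod p ]
  interpolate-correct g (suc m) w w<1+m
    rewrite binomialSum-snoc w 0 (interpolate g m) (g m + (p ∸ 1) * binomialSum m 0 (interpolate g m))
          | length-interpolate g m
    with m≤n⇒m<n∨m≡n (s≤s⁻¹ w<1+m)
  ... | inj₁ w<m = begin
    S + c * (w C m)  ≡⟨ cong (λ a → S + c * a) (k>n⇒nCk≡0 w<m) ⟩
    S + c * 0        ≡⟨ trans (cong (S +_) (*-zeroʳ c)) (+-identityʳ S) ⟩
    S                ≈⟨ interpolate-correct g m w w<m ⟩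
    g w              ∎
    where
    S c : ℕ
    S = binomialSum w 0 (interpolate g m)
    c = g m + (p ∸ 1) * binomialSum m 0 (interpolate g m)
  ... | inj₂ refl = begin
    S + c * (w C w)          ≡⟨ cong (λ a → S + c * a) (nCn≡1 w) ⟩
    S + c * 1                ≡⟨ cong (S +_) (*-identityʳ c) ⟩
    S + (g w + (p ∸ 1) * S)  ≡⟨ solve-negation ⟩
    g w + S * p              ≈⟨ mod-≡ ([m+kn]%n≡m%n (g w) S p) ⟩
    g w                      ∎
    where
    S c : ℕ
    S = binomialSum w 0 (interpolate g w)
    c = g w + (p ∸ 1) * S
    solve-negation : S + (g w + (p ∸ 1) * S) ≡ g w + S * p
    solve-negation = trans (rearrange S (g w) (p ∸ 1)) (cong (λ a → g w + S * a) (m∸n+n≡m (>-nonZero⁻¹ p)))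
      where
      rearrange : ∀ s a u → s + (a + u * s) ≡ a + s * (u + 1)
      rearrange = solve-∀

-- Monomials and symmetric polynomials over Boolean inputs

weight≤n : (x : Fin n → Bool) → weight x ≤ n
weight≤n {zero}  x = z≤n
weight≤n {suc n} x = +-mono-≤ (b2n≤1 (x zero)) (weight≤n (x ∘ suc))

monomial : List (Fin n) → (Fin n → Bool) → Bool
monomial S x = all x S

monomial-map-suc : (S : List (Fin n)) (x : Fin (suc n) → Bool) →
                   monomial (map suc S) x ≡ monomial S (x ∘ suc)
monomial-map-suc S x = cong and (sym (map-∘ S))

monomial-++ : (S T : List (Fin n)) (x : Fin n → Bool) →
              monomial (S ++ T) x ≡ monomial S x ∧ monomial T x
monomial-++ []      T x = refl
monomial-++ (i ∷ S) T x = trans (cong (x i ∧_) (monomial-++ S T x)) (sym (∧-assoc (x i) _ _))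

subsets : (n j : ℕ) → List (List (Fin n))
subsets n       zero    = [] ∷ []
subsets zero    (suc j) = []
subsets (suc n) (suc j) = map (map suc) (subsets n (suc j)) ++ map (λ S → zero ∷ map suc S) (subsets n j)

sumBy-subsets : ∀ n j (x : Fin n → Bool) →
                sumBy (λ S → b2n (monomial S x)) (subsets n j) ≡ weight x C j
sumBy-subsets n       zero    x = refl
sumBy-subsets zero    (suc j) x = refl
sumBy-subsets (suc n) (suc j) x = begin
  sumBy mon (map (map suc) L₁ ++ map (λ S → zero ∷ map suc S) L₀)
    ≡⟨ sumBy-++ mon (map (map suc) L₁) _ ⟩
  sumBy mon (map (map suc) L₁) + sumBy mon (map (λ S → zero ∷ map suc S) L₀)
    ≡⟨ cong₂ _+_ (trans (sumBy-map mon (map suc) L₁) (sumBy-cong L₁ λ S → cong b2n (monomial-map-suc S x)))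
                 (trans (sumBy-map mon _ L₀) (sumBy-cong L₀ λ S → trans (b2n-∧ (x zero) _)
                                                   (cong (λ b → b2n (x zero) * b2n b) (monomial-map-suc S x)))) ⟩
  sumBy mon′ L₁ + sumBy (λ S → b2n (x zero) * mon′ S) L₀
    ≡⟨ cong (sumBy mon′ L₁ +_) (sumBy-*ˡ (b2n (x zero)) mon′ L₀) ⟩
  sumBy mon′ L₁ + b2n (x zero) * sumBy mon′ L₀
    ≡⟨ cong₂ (λ a b → a + b2n (x zero) * b) (sumBy-subsets n (suc j) (x ∘ suc)) (sumBy-subsets n j (x ∘ suc)) ⟩
  w′ C suc j + b2n (x zero) * (w′ C j)
    ≡⟨ pascal (x zero) ⟩
  (b2n (x zero) + w′) C suc j
    ∎
  where
  open ≡-Reasoning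
  mon : List (Fin (suc n)) → ℕ
  mon S = b2n (monomial S x)
  mon′ : List (Fin n) → ℕ
  mon′ S = b2n (monomial S (x ∘ suc))
  w′ : ℕ
  w′ = weight (x ∘ suc)
  L₁ L₀ : List (List (Fin n))
  L₁ = subsets n (suc j)
  L₀ = subsets n j
  pascal : ∀ b → w′ C suc j + b2n b * (w′ C j) ≡ (b2n b + w′) C suc j
  pascal true  = trans (+-comm _ (1 * (w′ C j))) (trans (cong (_+ w′ C suc j) (*-identityˡ _)) (nCk+nC[k+1]≡[n+1]C[k+1] w′ j))
  pascal false = +-identityʳ _

subsets-length : ∀ n j → length (subsets n j) ≤ suc n ^ j
subsets-length n       zero    = ≤-refl
subsets-length zero    (suc j) = z≤n
subsets-length (suc n) (suc j) = begin
  length (map (map suc) (subsets n (suc j)) ++ map (λ S → zero ∷ map suc S) (subsets n j))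
    ≡⟨ trans (length-++ (map (map suc) (subsets n (suc j))))
             (cong₂ _+_ (length-map (map suc) (subsets n (suc j))) (length-map _ (subsets n j))) ⟩
  length (subsets n (suc j)) + length (subsets n j)
    ≤⟨ +-mono-≤ (subsets-length n (suc j)) (subsets-length n j) ⟩
  suc n * suc n ^ j + suc n ^ j
    ≤⟨ +-mono-≤ (*-monoʳ-≤ (suc n) (^-monoˡ-≤ j (n≤1+n (suc n)))) (^-monoˡ-≤ j (n≤1+n (suc n))) ⟩
  suc n * suc (suc n) ^ j + suc (suc n) ^ j
    ≡⟨ +-comm (suc n * suc (suc n) ^ j) _ ⟩
  suc (suc n) ^ suc j
    ∎
  where open ≤-Reasoning

subsets-degree : ∀ n j → All (λ S → length S ≡ j) (subsets n j)
subsets-degree n       zero    = refl ∷ []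
subsets-degree zero    (suc j) = []
subsets-degree (suc n) (suc j) =
  All.++⁺ (All.map⁺ (All.map (λ {S} |S|≡ → trans (length-map suc S) |S|≡) (subsets-degree n (suc j))))
          (All.map⁺ (All.map (λ {S} |S|≡ → cong suc (trans (length-map suc S) |S|≡)) (subsets-degree n j)))

Poly : ℕ → Set
Poly n = List (ℕ × List (Fin n))

evalTerm : (Fin n → Bool) → ℕ × List (Fin n) → ℕ
evalTerm x (c , S) = c * b2n (monomial S x)

⟦_⟧ : Poly n → (Fin n → Bool) → ℕ
⟦ P ⟧ x = sumBy (evalTerm x) P

symmetricPoly : ∀ n → ℕ → List ℕ → Poly n
symmetricPoly n j []       = []
symmetricPoly n j (c ∷ cs) = map (c ,_) (subsets n j) ++ symmetricPoly n (suc j) cs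

⟦symmetricPoly⟧ : ∀ n j cs (x : Fin n → Bool) → ⟦ symmetricPoly n j cs ⟧ x ≡ binomialSum (weight x) j cs
⟦symmetricPoly⟧ n j []       x = refl
⟦symmetricPoly⟧ n j (c ∷ cs) x = begin
  ⟦ map (c ,_) (subsets n j) ++ symmetricPoly n (suc j) cs ⟧ x
    ≡⟨ sumBy-++ (evalTerm x) (map (c ,_) (subsets n j)) _ ⟩
  ⟦ map (c ,_) (subsets n j) ⟧ x + ⟦ symmetricPoly n (suc j) cs ⟧ x
    ≡⟨ cong₂ _+_ (trans (sumBy-map (evalTerm x) (c ,_) (subsets n j)) (sumBy-*ˡ c _ (subsets n j)))
                 (⟦symmetricPoly⟧ n (suc j) cs x) ⟩
  c * sumBy (λ S → b2n (monomial S x)) (subsets n j) + binomialSum (weight x) (suc j) cs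
    ≡⟨ cong (λ a → c * a + binomialSum (weight x) (suc j) cs) (sumBy-subsets n j x) ⟩
  c * (weight x C j) + binomialSum (weight x) (suc j) cs
    ∎
  where open ≡-Reasoning

symmetricPoly-degree : ∀ n j cs → All (λ t → length (proj₂ t) < j + length cs) (symmetricPoly n j cs)
symmetricPoly-degree n j []       = []
symmetricPoly-degree n j (c ∷ cs) =
  All.++⁺ (All.map⁺ (All.map (λ |S|≡j → subst (_< j + suc (length cs)) (sym |S|≡j) j<j+1+cs) (subsets-degree n j)))
          (All.map (λ {t} → subst (length (proj₂ t) <_) (sym (+-suc j (length cs)))) (symmetricPoly-degree n (suc j) cs))
  where
  j<j+1+cs : j < j + suc (length cs)
  j<j+1+cs = m<m+n j z<s

symmetricPoly-length : ∀ n j cs → length (symmetricPoly n j cs) ≤ length cs * suc n ^ (j + length cs)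
symmetricPoly-length n j []       = z≤n
symmetricPoly-length n j (c ∷ cs) = begin
  length (map (c ,_) (subsets n j) ++ symmetricPoly n (suc j) cs)
    ≡⟨ trans (length-++ (map (c ,_) (subsets n j))) (cong (_+ _) (length-map (c ,_) (subsets n j))) ⟩
  length (subsets n j) + length (symmetricPoly n (suc j) cs)
    ≤⟨ +-mono-≤ (≤-trans (subsets-length n j) (^-monoʳ-≤ (suc n) (m≤m+n j (suc (length cs)))))
                (≤-trans (symmetricPoly-length n (suc j) cs)
                         (≤-reflexive (cong (λ e → length cs * suc n ^ e) (sym (+-suc j (length cs)))))) ⟩
  suc n ^ (j + suc (length cs)) + length cs * suc n ^ (j + suc (length cs))
    ∎
  where open ≤-Reasoning

module PrimePower {p : ℕ} (p-prime : Prime p) (e : ℕ) where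

  q : ℕ
  q = p ^ e

  instance
    p≢0 : NonZero p
    p≢0 = prime⇒nonZero p-prime

    q≢0 : NonZero q
    q≢0 = m^n≢0 p e

  open ≡-mod-Reasoning {p}

  p∣qC[1+j] : ∀ {j} → suc j < q → p ∣ q C suc j
  p∣qC[1+j] {j} 1+j<q with p ∣? q C suc j
  ... | yes p∣ = p∣
  ... | no  p∤ = contradiction (∣⇒≤ q∣1+j) (<⇒≱ 1+j<q)
    where
    q∣1+j : q ∣ suc j
    q∣1+j = coprime-divisor (coprime-^ˡ (prime∤⇒coprime p-prime p∤) e) (n∣nC[1+k]*[1+k] q j)

  C-shift : ∀ w j → j < q → (w + q) C j ≡ w C j [mod p ]
  C-shift w       zero    _     = mod-≡ refl
  C-shift zero    (suc j) 1+j<q = mod-≡ (trans (n∣m⇒m%n≡0 _ p (p∣qC[1+j] 1+j<q)) (sym (m<n⇒m%n≡m (>-nonZero⁻¹ p))))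
  C-shift (suc w) (suc j) 1+j<q = begin
    suc (w + q) C suc j               ≡⟨ nCk+nC[k+1]≡[n+1]C[k+1] (w + q) j ⟨
    (w + q) C j + (w + q) C suc j     ≈⟨ +-cong-mod (C-shift w j (<-trans (n<1+n j) 1+j<q)) (C-shift w (suc j) 1+j<q) ⟩
    w C j + w C suc j                 ≡⟨ nCk+nC[k+1]≡[n+1]C[k+1] w j ⟩
    suc w C suc j                     ∎

  C-shifts : ∀ r k j → j < q → (r + k * q) C j ≡ r C j [mod p ]
  C-shifts r zero    j _   = ≡⇒≡-mod (cong (_C j) (+-identityʳ r))
  C-shifts r (suc k) j j<q = begin
    (r + (q + k * q)) C j   ≡⟨ cong (_C j) (trans (cong (r +_) (+-comm q (k * q))) (sym (+-assoc r (k * q) q))) ⟩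
    (r + k * q + q) C j     ≈⟨ C-shift (r + k * q) j j<q ⟩
    (r + k * q) C j         ≈⟨ C-shifts r k j j<q ⟩
    r C j                   ∎

  C-periodic : ∀ w j → j < q → w C j ≡ (w % q) C j [mod p ]
  C-periodic w j j<q = begin
    w C j                         ≡⟨ cong (_C j) (m≡m%n+[m/n]*n w q) ⟩
    (w % q + (w / q) * q) C j     ≈⟨ C-shifts (w % q) (w / q) j j<q ⟩
    (w % q) C j                   ∎

  binomialSum-periodic : ∀ w j cs → j + length cs ≤ q →
                         binomialSum w j cs ≡ binomialSum (w % q) j cs [mod p ]
  binomialSum-periodic w j []       _         = mod-≡ refl
  binomialSum-periodic w j (c ∷ cs) j+1+cs≤q =
    +-cong-mod (*-congˡ-mod c (C-periodic w j (<-≤-trans (m<m+n j z<s) j+1+cs≤q)))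
               (binomialSum-periodic w (suc j) cs (subst (_≤ q) (+-suc j (length cs)) j+1+cs≤q))

  periodic-expansion : (g : ℕ → ℕ) → (∀ w → g (w % q) ≡ g w) →
                       ∀ w → binomialSum w 0 (interpolate p g q) ≡ g w [mod p ]
  periodic-expansion g g-periodic w = begin
    binomialSum w 0 cs         ≈⟨ binomialSum-periodic w 0 cs (≤-reflexive (length-interpolate p g q)) ⟩
    binomialSum (w % q) 0 cs   ≈⟨ interpolate-correct p g q (w % q) (m%n<n w q) ⟩
    g (w % q)                  ≡⟨ g-periodic w ⟩
    g w                        ∎
    where cs = interpolate p g q

  congruent : ℕ → ℕ → Bool
  congruent t w = w % q ≡ᵇ t % q

  indicatorCoefficients : ℕ → List ℕ
  indicatorCoefficients t = interpolate p (b2n ∘ congruent t) q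

  indicatorPoly : ∀ n → ℕ → Poly n
  indicatorPoly n t = symmetricPoly n 0 (indicatorCoefficients t)

  ⟦indicatorPoly⟧ : ∀ t (x : Fin n → Bool) → ⟦ indicatorPoly n t ⟧ x ≡ b2n (congruent t (weight x)) [mod p ]
  ⟦indicatorPoly⟧ {n} t x = begin
    ⟦ indicatorPoly n t ⟧ x                                    ≡⟨ ⟦symmetricPoly⟧ n 0 (indicatorCoefficients t) x ⟩
    binomialSum (weight x) 0 (indicatorCoefficients t)         ≈⟨ periodic-expansion (b2n ∘ congruent t) periodic (weight x) ⟩
    b2n (congruent t (weight x))                               ∎
    where
    periodic : ∀ w → b2n (congruent t (w % q)) ≡ b2n (congruent t w)
    periodic w = cong (λ r → b2n (r ≡ᵇ t % q)) (m%n%n≡m%n w q)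

  indicatorPoly-degree : ∀ n t → All (λ cS → length (proj₂ cS) < q) (indicatorPoly n t)
  indicatorPoly-degree n t = subst (λ d → All (λ cS → length (proj₂ cS) < d) (indicatorPoly n t))
    (length-interpolate p (b2n ∘ congruent t) q) (symmetricPoly-degree n 0 (indicatorCoefficients t))

  indicatorPoly-length : ∀ n t → length (indicatorPoly n t) ≤ q * suc n ^ q
  indicatorPoly-length n t = subst (λ d → length (indicatorPoly n t) ≤ d * suc n ^ d)
    (length-interpolate p (b2n ∘ congruent t) q) (symmetricPoly-length n 0 (indicatorCoefficients t))

-- Weighted sums of MOD₅ gates

linear : (Fin n → ℕ) → (Fin n → Bool) → ℕ
linear a x = sumFin (λ i → a i * b2n (x i))

isZero₅ : ℕ → ℕ
isZero₅ s = b2n (modGate 5 s)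

GateSum : ℕ → Set
GateSum n = List (ℕ × (Fin n → ℕ))

evalGate : (Fin n → Bool) → ℕ × (Fin n → ℕ) → ℕ
evalGate x (c , a) = c * isZero₅ (linear a x)

⟦_⟧₅ : GateSum n → (Fin n → Bool) → ℕ
⟦ L ⟧₅ x = sumBy (evalGate x) L

⟦⟧₅-++ : (L M : GateSum n) (x : Fin n → Bool) → ⟦ L ++ M ⟧₅ x ≡ ⟦ L ⟧₅ x + ⟦ M ⟧₅ x
⟦⟧₅-++ L M x = sumBy-++ (evalGate x) L M

scaleGates : ℕ → GateSum n → GateSum n
scaleGates c = map (λ (d , a) → (c * d , a))

⟦scaleGates⟧₅ : ∀ c (L : GateSum n) x → ⟦ scaleGates c L ⟧₅ x ≡ c * ⟦ L ⟧₅ x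
⟦scaleGates⟧₅ c L x =
  trans (sumBy-map (evalGate x) _ L) (trans (sumBy-cong L (λ (d , a) → *-assoc c d _)) (sumBy-*ˡ c (evalGate x) L))

0ᶠ : Fin n → ℕ
0ᶠ _ = 0

linear-0ᶠ : (x : Fin n → Bool) → linear 0ᶠ x ≡ 0
linear-0ᶠ {zero}  x = refl
linear-0ᶠ {suc n} x = linear-0ᶠ (x ∘ suc)

unit : Fin n → ℕ → Fin n → ℕ
unit zero    b zero    = b
unit zero    b (suc k) = 0
unit (suc i) b zero    = 0
unit (suc i) b (suc k) = unit i b k

linear-unit : (i : Fin n) (b : ℕ) (x : Fin n → Bool) → linear (unit i b) x ≡ b * b2n (x i)
linear-unit {suc n} zero    b x = trans (cong (b * b2n (x zero) +_) (linear-0ᶠ (x ∘ suc))) (+-identityʳ _)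
linear-unit {suc n} (suc i) b x = linear-unit i b (x ∘ suc)

addAt : (Fin n → ℕ) → Fin n → ℕ → Fin n → ℕ
addAt a i b k = a k + unit i b k

linear-addAt : (a : Fin n → ℕ) (i : Fin n) (b : ℕ) (x : Fin n → Bool) →
               linear (addAt a i b) x ≡ linear a x + b * b2n (x i)
linear-addAt a i b x = begin
  sumFin (λ k → (a k + unit i b k) * b2n (x k))
    ≡⟨ sumFin-cong (λ k → *-distribʳ-+ (b2n (x k)) (a k) (unit i b k)) ⟩
  sumFin (λ k → a k * b2n (x k) + unit i b k * b2n (x k))
    ≡⟨ sumFin-+ (λ k → a k * b2n (x k)) _ ⟩
  linear a x + linear (unit i b) x
    ≡⟨ cong (linear a x +_) (linear-unit i b x) ⟩
  linear a x + b * b2n (x i)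
    ∎
  where open ≡-Reasoning

extend : List ℕ → Fin n → List (Fin n → ℕ) → List (Fin n → ℕ)
extend B i L = concatMap (λ b → map (λ a → addAt a i b) L) B

combos : List ℕ → List (Fin n) → List (Fin n → ℕ)
combos A []      = 0ᶠ ∷ []
combos A (i ∷ S) = extend A i (combos A S)

-- number of a ∈ Aᵘ with r + ∑ a ≡ 0 mod 5
count : List ℕ → ℕ → ℕ → ℕ
count A zero    r = isZero₅ r
count A (suc u) r = sumBy (λ b → count A u (r + b)) A

count-cong : ∀ A u {a b} → a ≡ b [mod 5 ] → count A u a ≡ count A u b
count-cong A zero    (mod-≡ a≡b) = cong (λ s → b2n (s ≡ᵇ 0)) a≡b
count-cong A (suc u) a≡b         = sumBy-cong A (λ c → count-cong A u (+-cong-mod a≡b (≡-mod-refl {a = c})))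

zeroes : List (Fin n → ℕ) → (Fin n → Bool) → ℕ → ℕ
zeroes L x r = sumBy (λ a → isZero₅ (linear a x + r)) L

zeroes-extend : ∀ B (i : Fin n) L x r →
                zeroes (extend B i L) x r ≡ sumBy (λ b → zeroes L x (r + b * b2n (x i))) B
zeroes-extend B i L x r = begin
  zeroes (extend B i L) x r
    ≡⟨ sumBy-concatMap _ _ B ⟩
  sumBy (λ b → zeroes (map (λ a → addAt a i b) L) x r) B
    ≡⟨ sumBy-cong B (λ b → trans (sumBy-map _ _ L) (sumBy-cong L (λ a → cong isZero₅ (shift a b)))) ⟩
  sumBy (λ b → zeroes L x (r + b * b2n (x i))) B
    ∎
  where
  open ≡-Reasoning
  shift : ∀ a b → linear (addAt a i b) x + r ≡ linear a x + (r + b * b2n (x i))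
  shift a b = trans (cong (_+ r) (linear-addAt a i b x)) (trans (+-assoc (linear a x) _ r)
                    (cong (linear a x +_) (+-comm (b * b2n (x i)) r)))

combos-length : ∀ A (S : List (Fin n)) → length (combos A S) ≡ length A ^ length S
combos-length A []      = refl
combos-length A (i ∷ S) = begin
  length (extend A i (combos A S))
    ≡⟨ length-concatMap _ A ⟩
  sumBy (λ b → length (map (λ a → addAt a i b) (combos A S))) A
    ≡⟨ sumBy-cong A (λ b → trans (length-map _ (combos A S)) (combos-length A S)) ⟩
  sumBy (λ _ → length A ^ length S) A
    ≡⟨ sumBy-const _ A ⟩
  length A * length A ^ length S
    ∎
  where open ≡-Reasoning

module _ (p : ℕ) .{{_ : NonZero p}} where

  open ≡-mod-Reasoning {p}

  -- Offsets of a vanishing input contribute |B| ≡ 0 copies of the same sum.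
  zeroes-extend-mod : ∀ B → length B ≡ 0 [mod p ] → (i : Fin n) → ∀ L x β (h : ℕ → ℕ) →
    (∀ r → zeroes L x r ≡ b2n β * h r [mod p ]) →
    ∀ r → zeroes (extend B i L) x r ≡ b2n (x i ∧ β) * sumBy (λ b → h (r + b)) B [mod p ]
  zeroes-extend-mod B |B|≡0 i L x β h L≡ r with x i in xᵢ≡
  ... | true = begin
    zeroes (extend B i L) x r                  ≡⟨ zeroes-extend B i L x r ⟩
    sumBy (λ b → zeroes L x (r + b * b2n (x i))) B ≡⟨ cong (λ v → sumBy (λ b → zeroes L x (r + b * b2n v)) B) xᵢ≡ ⟩
    sumBy (λ b → zeroes L x (r + b * 1)) B     ≈⟨ sumBy-cong-mod B (λ b → L≡ (r + b * 1)) ⟩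
    sumBy (λ b → b2n β * h (r + b * 1)) B      ≡⟨ sumBy-*ˡ (b2n β) _ B ⟩
    b2n β * sumBy (λ b → h (r + b * 1)) B      ≡⟨ cong (b2n β *_) (sumBy-cong B (λ b → cong (λ c → h (r + c)) (*-identityʳ b))) ⟩
    b2n β * sumBy (λ b → h (r + b)) B          ∎
  ... | false = begin
    zeroes (extend B i L) x r                  ≡⟨ zeroes-extend B i L x r ⟩
    sumBy (λ b → zeroes L x (r + b * b2n (x i))) B ≡⟨ cong (λ v → sumBy (λ b → zeroes L x (r + b * b2n v)) B) xᵢ≡ ⟩
    sumBy (λ b → zeroes L x (r + b * 0)) B     ≡⟨ sumBy-cong B (λ b → cong (λ c → zeroes L x (r + c)) (*-zeroʳ b)) ⟩
    sumBy (λ _ → zeroes L x (r + 0)) B         ≡⟨ sumBy-const _ B ⟩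
    length B * zeroes L x (r + 0)              ≈⟨ *-cong-mod |B|≡0 (≡-mod-refl {a = zeroes L x (r + 0)}) ⟩
    0                                          ∎

  combos-zeroes : ∀ A → length A ≡ 0 [mod p ] → (S : List (Fin n)) → ∀ x r →
                  zeroes (combos A S) x r ≡ b2n (monomial S x) * count A (length S) r [mod p ]
  combos-zeroes A |A|≡0 []      x r =
    ≡⇒≡-mod (trans (+-identityʳ _) (trans (cong (λ s → isZero₅ (s + r)) (linear-0ᶠ x)) (sym (+-identityʳ _))))
  combos-zeroes A |A|≡0 (i ∷ S) x r =
    zeroes-extend-mod A |A|≡0 i (combos A S) x (monomial S x) (count A (length S)) (combos-zeroes A |A|≡0 S x) r

record Normaliser (p : ℕ) .{{_ : NonZero p}} (h : ℕ → ℕ) : Set where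
  field
    offsets        : List ℕ
    scale          : ℕ
    length-offsets : length offsets ≡ p
    normalises     : scale * sumBy h offsets ≡ 1 [mod p ]

module MonomialGates (p : ℕ) .{{_ : NonZero p}} (A : List ℕ) (|A|≡0 : length A ≡ 0 [mod p ])
                     (normaliser : ∀ u → Normaliser p (count A u)) where

  open Normaliser

  -- For S = i ∷ S′, vary the coefficient of xᵢ over the offsets and the others over A: by
  -- zeroes-extend-mod these gates sum to x^S · ∑ count, which the scale normalises to x^S.
  monomialGates : List (Fin n) → GateSum n
  monomialGates []      = (1 , 0ᶠ) ∷ []
  monomialGates (i ∷ S) = map (scale N ,_) (extend (offsets N) i (combos A S))
    where N = normaliser (length S)

  ⟦monomialGates⟧₅ : (S : List (Fin n)) (x : Fin n → Bool) → ⟦ monomialGates S ⟧₅ x ≡ b2n (monomial S x) [mod p ]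
  ⟦monomialGates⟧₅ []      x = ≡⇒≡-mod (trans (+-identityʳ _) (trans (+-identityʳ _) (cong (b2n ∘ modGate 5) (linear-0ᶠ x))))
  ⟦monomialGates⟧₅ {n} (i ∷ S) x = begin
    ⟦ map (κ ,_) L ⟧₅ x                ≡⟨ sumBy-map (evalGate x) (κ ,_) L ⟩
    sumBy (λ a → κ * isZero₅ (linear a x)) L
                                       ≡⟨ sumBy-*ˡ κ _ L ⟩
    κ * sumBy (λ a → isZero₅ (linear a x)) L
                                       ≡⟨ cong (κ *_) (sumBy-cong L (λ a → cong isZero₅ (sym (+-identityʳ (linear a x))))) ⟩
    κ * zeroes L x 0                   ≈⟨ *-congˡ-mod κ (zeroes-extend-mod p Δ |Δ|≡0 i (combos A S) x
                                            (monomial S x) (count A u) (combos-zeroes p A |A|≡0 S x) 0) ⟩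
    κ * (M * sumBy (count A u) Δ)      ≡⟨ x∙yz≈y∙xz κ M _ ⟩
    M * (κ * sumBy (count A u) Δ)      ≈⟨ *-congˡ-mod M (normalises N) ⟩
    M * 1                              ≡⟨ *-identityʳ M ⟩
    M                                  ∎
    where
    open ≡-mod-Reasoning {p}
    u : ℕ
    u = length S
    N : Normaliser p (count A u)
    N = normaliser u
    κ : ℕ
    κ = scale N
    Δ : List ℕ
    Δ = offsets N
    L : List (Fin n → ℕ)
    L = extend Δ i (combos A S)
    M : ℕ
    M = b2n (monomial (i ∷ S) x)
    |Δ|≡0 : length Δ ≡ 0 [mod p ]
    |Δ|≡0 = mod-≡ (trans (cong (_% p) (length-offsets N)) (%-≡ m≡0-mod))

  monomialGates-length : 1 ≤ length A → (S : List (Fin n)) → length (monomialGates S) ≤ p * length A ^ length S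
  monomialGates-length _     []      = subst (1 ≤_) (sym (*-identityʳ p)) (>-nonZero⁻¹ p)
  monomialGates-length 1≤|A| (i ∷ S) = begin
    length (map (scale N ,_) (extend Δ i (combos A S)))
      ≡⟨ trans (length-map _ (extend Δ i (combos A S))) (length-concatMap _ Δ) ⟩
    sumBy (λ b → length (map (λ a → addAt a i b) (combos A S))) Δ
      ≡⟨ sumBy-cong Δ (λ b → trans (length-map _ (combos A S)) (combos-length A S)) ⟩
    sumBy (λ _ → length A ^ length S) Δ
      ≡⟨ sumBy-const _ Δ ⟩
    length Δ * length A ^ length S
      ≡⟨ cong (_* _) (length-offsets N) ⟩
    p * length A ^ length S
      ≤⟨ *-monoʳ-≤ p (^-monoʳ-≤′ (length S)) ⟩
    p * length A ^ suc (length S)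
      ∎
    where
    open ≤-Reasoning
    N : Normaliser p (count A (length S))
    N = normaliser (length S)
    Δ : List ℕ
    Δ = offsets N
    ^-monoʳ-≤′ : ∀ k → length A ^ k ≤ length A ^ suc k
    ^-monoʳ-≤′ k = ^-monoʳ-≤ (length A) {{>-nonZero 1≤|A|}} (n≤1+n k)

  termGates : List (Fin n) → ℕ × List (Fin n) → GateSum n
  termGates T (c , S) = scaleGates c (monomialGates (T ++ S))

  polyGates : List (Fin n) → Poly n → GateSum n
  polyGates T = concatMap (termGates T)

  ⟦polyGates⟧₅ : (T : List (Fin n)) (P : Poly n) (x : Fin n → Bool) →
                 ⟦ polyGates T P ⟧₅ x ≡ b2n (monomial T x) * ⟦ P ⟧ x [mod p ]
  ⟦polyGates⟧₅ T P x = begin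
    ⟦ polyGates T P ⟧₅ x                                  ≡⟨ sumBy-concatMap (evalGate x) (termGates T) P ⟩
    sumBy (λ cS → ⟦ termGates T cS ⟧₅ x) P                ≈⟨ sumBy-cong-mod P term ⟩
    sumBy (λ cS → b2n (monomial T x) * evalTerm x cS) P   ≡⟨ sumBy-*ˡ (b2n (monomial T x)) (evalTerm x) P ⟩
    b2n (monomial T x) * ⟦ P ⟧ x                          ∎
    where
    open ≡-mod-Reasoning {p}
    term : ∀ cS → ⟦ termGates T cS ⟧₅ x ≡ b2n (monomial T x) * evalTerm x cS [mod p ]
    term (c , S) = begin
      ⟦ scaleGates c (monomialGates (T ++ S)) ⟧₅ x      ≡⟨ ⟦scaleGates⟧₅ c (monomialGates (T ++ S)) x ⟩
      c * ⟦ monomialGates (T ++ S) ⟧₅ x                 ≈⟨ *-congˡ-mod c (⟦monomialGates⟧₅ (T ++ S) x) ⟩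
      c * b2n (monomial (T ++ S) x)                     ≡⟨ cong (λ b → c * b2n b) (monomial-++ T S x) ⟩
      c * b2n (monomial T x ∧ monomial S x)             ≡⟨ cong (c *_) (b2n-∧ (monomial T x) _) ⟩
      c * (b2n (monomial T x) * b2n (monomial S x))     ≡⟨ x∙yz≈y∙xz c (b2n (monomial T x)) (b2n (monomial S x)) ⟩
      b2n (monomial T x) * (c * b2n (monomial S x))     ∎

  polyGates-length : 1 ≤ length A → ∀ d (T : List (Fin n)) (P : Poly n) → All (λ cS → length (proj₂ cS) < d) P →
                     length (polyGates T P) ≤ length P * (p * length A ^ (length T + d))
  polyGates-length 1≤|A| d T P deg<d = begin
    length (polyGates T P)                         ≡⟨ length-concatMap (termGates T) P ⟩
    sumBy (length ∘ termGates T) P                 ≤⟨ sumBy-≤ (All.map (λ {cS} → term {cS}) deg<d) ⟩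
    length P * (p * length A ^ (length T + d))     ∎
    where
    open ≤-Reasoning
    term : ∀ {cS} → length (proj₂ cS) < d → length (termGates T cS) ≤ p * length A ^ (length T + d)
    term {c , S} |S|<d = begin
      length (scaleGates c (monomialGates (T ++ S)))  ≡⟨ length-map _ (monomialGates (T ++ S)) ⟩
      length (monomialGates (T ++ S))                 ≤⟨ monomialGates-length 1≤|A| (T ++ S) ⟩
      p * length A ^ length (T ++ S)                  ≤⟨ *-monoʳ-≤ p (^-monoʳ-≤ (length A) {{>-nonZero 1≤|A|}}
                                                            (≤-trans (≤-reflexive (length-++ T)) (+-monoʳ-≤ (length T) (<⇒≤ |S|<d)))) ⟩
      p * length A ^ (length T + d)                   ∎

-- The residues mod p of count A u r (r < 5) evolve by a fixed map on Vec ℕ 5; a brute-force check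
-- of that map on all residue vectors shows that they never become constant.
module CountResidues (p : ℕ) .{{_ : NonZero p}} (A : List ℕ) where

  state : ℕ → Vec ℕ 5
  state u = tabulate (λ r → count A u (toℕ r) % p)

  step : Vec ℕ 5 → Vec ℕ 5
  step v = tabulate (λ r → sumBy (λ b → Vec.lookup v ((toℕ r + b) mod 5)) A % p)

  state-step : ∀ u → state (suc u) ≡ step (state u)
  state-step u = tabulate-cong (λ r → %-≡ (sumBy-cong-mod A (λ b → reduce (toℕ r + b))))
    where
    reduce : ∀ s → count A u s ≡ Vec.lookup (state u) (s mod 5) [mod p ]
    reduce s = begin
      count A u s                        ≡⟨ count-cong A u (%-≡-mod s) ⟨
      count A u (s % 5)                  ≡⟨ cong (count A u) (toℕ-fromℕ< (m%n<n s 5)) ⟨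
      count A u (toℕ (s mod 5))          ≈⟨ %-≡-mod (count A u (toℕ (s mod 5))) ⟨
      count A u (toℕ (s mod 5)) % p      ≡⟨ lookup∘tabulate (λ r → count A u (toℕ r) % p) (s mod 5) ⟨
      Vec.lookup (state u) (s mod 5)     ∎
      where open ≡-mod-Reasoning {p}

  witness : Vec ℕ 5 → Fin 5
  witness (a ∷ b ∷ c ∷ d ∷ _ ∷ []) =
    if not (b ≡ᵇ a) then # 1 else if not (c ≡ᵇ a) then # 2 else if not (d ≡ᵇ a) then # 3 else # 4

  nonConstant : Vec ℕ 5 → Bool
  nonConstant v = not (Vec.lookup v (witness v) ≡ᵇ Vec.head v)

  balance : Vec ℕ 5 → ℕ
  balance v = Vec.head v + (p ∸ 1) * Vec.lookup v (witness v)

  Invariant : Vec ℕ 5 → Bool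
  Invariant v = if nonConstant v then nonConstant (step v) ∧ (balance v * balance v % p ≡ᵇ 1 % p) else true

  residueVec : (a b c d e : Fin p) → Vec ℕ 5
  residueVec a b c d e = Vec.map toℕ (a ∷ b ∷ c ∷ d ∷ e ∷ [])

  invariant? : Dec (∀ a b c d e → Invariant (residueVec a b c d e) ≡ true)
  invariant? = all? λ a → all? λ b → all? λ c → all? λ d → all? λ e → Invariant (residueVec a b c d e) ≟ᵇ true

  module _ (invariant : ∀ a b c d e → Invariant (residueVec a b c d e) ≡ true)
           (nonConstant-state₀ : nonConstant (state 0) ≡ true) where

    invariant-state : ∀ u → Invariant (state u) ≡ true
    invariant-state u = subst (λ v → Invariant v ≡ true) (sym state≡)
      (invariant (residue (# 0)) (residue (# 1)) (residue (# 2)) (residue (# 3)) (residue (# 4)))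
      where
      residue : Fin 5 → Fin p
      residue r = fromℕ< (m%n<n (count A u (toℕ r)) p)
      state≡ : state u ≡ tabulate (toℕ ∘ residue)
      state≡ = tabulate-cong {f = λ r → count A u (toℕ r) % p} (λ r → sym (toℕ-fromℕ< (m%n<n (count A u (toℕ r)) p)))

    invariant-sound : ∀ v → Invariant v ≡ true → nonConstant v ≡ true →
                      (nonConstant (step v) ≡ true) × (balance v * balance v ≡ 1 [mod p ])
    invariant-sound v inv nc rewrite nc
      with nonConstant (step v) | balance v * balance v % p ≡ᵇ 1 % p in square≡1 | inv
    ... | true | true | _ = refl , mod-≡ (≡ᵇ⇒≡ _ _ (subst T (sym square≡1) _))

    nonConstant-state : ∀ u → nonConstant (state u) ≡ true
    nonConstant-state zero    = nonConstant-state₀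
    nonConstant-state (suc u) = trans (cong nonConstant (state-step u))
      (proj₁ (invariant-sound (state u) (invariant-state u) (nonConstant-state u)))

    -- Offset 0 and p ∸ 1 copies of the witness s sum to count 0 - count s ≢ 0 mod p, and for p = 2, 3
    -- such a unit is its own inverse.
    normaliser : ∀ u → Normaliser p (count A u)
    normaliser u = record
      { offsets        = 0 ∷ replicate (p ∸ 1) (toℕ s)
      ; scale          = balance v
      ; length-offsets = trans (cong suc (length-replicate (p ∸ 1))) (trans (+-comm 1 (p ∸ 1)) (m∸n+n≡m (>-nonZero⁻¹ p)))
      ; normalises     = begin
          balance v * sumBy (count A u) (0 ∷ replicate (p ∸ 1) (toℕ s))
            ≡⟨ cong (λ a → balance v * (count A u 0 + a)) (sumBy-replicate (count A u) (p ∸ 1) (toℕ s)) ⟩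
          balance v * (count A u 0 + (p ∸ 1) * count A u (toℕ s))
            ≈⟨ *-congˡ-mod (balance v) sum≡balance ⟩
          balance v * balance v
            ≈⟨ proj₂ (invariant-sound v (invariant-state u) (nonConstant-state u)) ⟩
          1 ∎
      }
      where
      open ≡-mod-Reasoning {p}
      v : Vec ℕ 5
      v = state u
      s : Fin 5
      s = witness v
      sum≡balance : count A u 0 + (p ∸ 1) * count A u (toℕ s) ≡ balance v [mod p ]
      sum≡balance = begin
        count A u 0 + (p ∸ 1) * count A u (toℕ s)
          ≈⟨ +-cong-mod (%-≡-mod (count A u 0)) (*-congˡ-mod (p ∸ 1) (%-≡-mod (count A u (toℕ s)))) ⟨
        count A u 0 % p + (p ∸ 1) * (count A u (toℕ s) % p)
          ≡⟨ cong (λ a → count A u 0 % p + (p ∸ 1) * a) (lookup∘tabulate (λ r → count A u (toℕ r) % p) s) ⟨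
        balance v ∎

normaliser₂ : ∀ u → Normaliser 2 (count (upTo 2) u)
normaliser₂ = CountResidues.normaliser 2 (upTo 2) (from-yes (CountResidues.invariant? 2 (upTo 2))) refl

normaliser₃ : ∀ u → Normaliser 3 (count (upTo 3) u)
normaliser₃ = CountResidues.normaliser 3 (upTo 3) (from-yes (CountResidues.invariant? 3 (upTo 3))) refl

-- A MOD₆ gate as the conjunction of a mod-2 and a mod-3 condition

-- 3 * a mod 6 only depends on a mod 2, and 2 * b only on b mod 3.
and₆ : ∀ {a b} β γ → a ≡ b2n β [mod 2 ] → b ≡ b2n γ [mod 3 ] →
       b2n (modGate 6 (3 * (a + 1) + 2 * (b + 2))) ≡ b2n (β ∧ γ)
and₆ {a} {b} β γ a≡β b≡γ = trans (cong (λ s → b2n (s ≡ᵇ 0)) (%-≡ reduce)) (table β γ)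
  where
  reduce : 3 * (a + 1) + 2 * (b + 2) ≡ 3 * (b2n β + 1) + 2 * (b2n γ + 2) [mod 6 ]
  reduce = +-cong-mod (*-cong-mod-scale 2 3 (+-cong-mod a≡β (≡-mod-refl {a = 1})))
                      (*-cong-mod-scale 3 2 (+-cong-mod b≡γ (≡-mod-refl {a = 2})))
  table : ∀ β γ → b2n (modGate 6 (3 * (b2n β + 1) + 2 * (b2n γ + 2))) ≡ b2n (β ∧ γ)
  table true  true  = refl
  table true  false = refl
  table false true  = refl
  table false false = refl

andGates : GateSum n → GateSum n → GateSum n
andGates L M = scaleGates 3 L ++ scaleGates 2 M ++ (3 , 0ᶠ) ∷ (4 , 0ᶠ) ∷ []

⟦andGates⟧₅ : (L M : GateSum n) (x : Fin n → Bool) → ⟦ andGates L M ⟧₅ x ≡ 3 * (⟦ L ⟧₅ x + 1) + 2 * (⟦ M ⟧₅ x + 2)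
⟦andGates⟧₅ L M x
  rewrite ⟦⟧₅-++ (scaleGates 3 L) (scaleGates 2 M ++ (3 , 0ᶠ) ∷ (4 , 0ᶠ) ∷ []) x
        | ⟦⟧₅-++ (scaleGates 2 M) ((3 , 0ᶠ) ∷ (4 , 0ᶠ) ∷ []) x
        | ⟦scaleGates⟧₅ 3 L x | ⟦scaleGates⟧₅ 2 M x | linear-0ᶠ x = rearrange (⟦ L ⟧₅ x) (⟦ M ⟧₅ x)
  where
  rearrange : ∀ a b → 3 * a + (2 * b + (3 * 1 + (4 * 1 + 0))) ≡ 3 * (a + 1) + 2 * (b + 2)
  rearrange = solve-∀

andGates-correct : (L M : GateSum n) (x : Fin n → Bool) → ∀ β γ →
                   ⟦ L ⟧₅ x ≡ b2n β [mod 2 ] → ⟦ M ⟧₅ x ≡ b2n γ [mod 3 ] →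
                   b2n (modGate 6 (⟦ andGates L M ⟧₅ x)) ≡ b2n (β ∧ γ)
andGates-correct L M x β γ L≡β M≡γ = trans (cong (b2n ∘ modGate 6) (⟦andGates⟧₅ L M x)) (and₆ β γ L≡β M≡γ)

mod₅-output : ∀ s b → s ≡ (if b then 0 else 1) [mod 5 ] → modGate 5 s ≡ b × (s % 5 ≡ 0 ⊎ s % 5 ≡ 1)
mod₅-output s true  (mod-≡ s≡0) = cong (_≡ᵇ 0) s≡0 , inj₁ s≡0
mod₅-output s false (mod-≡ s≡1) = cong (_≡ᵇ 0) s≡1 , inj₂ s≡1

-- Assembling a circuit from its middle gates

-- a middle MOD₆ gate: its wire multiplicity into the output gate and the MOD₅ gates feeding it
MidGate : ℕ → Set
MidGate n = ℕ × GateSum n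

-- the bottom gates, each tagged with the index of the middle gate it feeds
tagged : ℕ → List (MidGate n) → List (ℕ × ℕ × (Fin n → ℕ))
tagged k []             = []
tagged k ((_ , L) ∷ Ms) = map (k ,_) L ++ tagged (suc k) Ms

circuit : List (MidGate n) → Circuit n
circuit Ms = record
  { mid  = length Ms
  ; bot  = length (tagged 0 Ms)
  ; wBot = λ j → proj₂ (proj₂ (lookup (tagged 0 Ms) j))
  ; wMid = λ k j → if proj₁ (lookup (tagged 0 Ms) j) ≡ᵇ toℕ k then proj₁ (proj₂ (lookup (tagged 0 Ms) j)) else 0
  ; wTop = λ k → proj₁ (lookup Ms k)
  }

evalMid : (Fin n → Bool) → MidGate n → ℕ
evalMid x (w , L) = w * b2n (modGate 6 (⟦ L ⟧₅ x))

module _ (x : Fin n → Bool) where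

  inputTo : ℕ → ℕ × ℕ × (Fin n → ℕ) → ℕ
  inputTo k (t , c , a) = (if t ≡ᵇ k then c else 0) * isZero₅ (linear a x)

  inputTo-own : ∀ k (L : GateSum n) → sumBy (inputTo k) (map (k ,_) L) ≡ ⟦ L ⟧₅ x
  inputTo-own k L = trans (sumBy-map (inputTo k) (k ,_) L)
    (sumBy-cong L (λ (c , a) → cong (λ b → (if b then c else 0) * isZero₅ (linear a x)) (≡ᵇ-refl k)))

  inputTo-other : ∀ {k} s (L : GateSum n) → s ≢ k → sumBy (inputTo k) (map (s ,_) L) ≡ 0
  inputTo-other {k} s L s≢k = begin
    sumBy (inputTo k) (map (s ,_) L)  ≡⟨ sumBy-map (inputTo k) (s ,_) L ⟩
    sumBy (inputTo k ∘ (s ,_)) L      ≡⟨ sumBy-cong L (λ (c , a) → cong (λ b → (if b then c else 0) * isZero₅ (linear a x))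
                                                                       (≢⇒≡ᵇ-false s≢k)) ⟩
    sumBy (λ _ → 0) L                 ≡⟨ sumBy-const 0 L ⟩
    length L * 0                      ≡⟨ *-zeroʳ (length L) ⟩
    0                                 ∎
    where open ≡-Reasoning

  tagged-below : ∀ {k} s (Ms : List (MidGate n)) → k < s → sumBy (inputTo k) (tagged s Ms) ≡ 0
  tagged-below s []             _   = refl
  tagged-below s ((_ , L) ∷ Ms) k<s = trans (sumBy-++ _ (map (s ,_) L) _)
    (cong₂ _+_ (inputTo-other s L (≢-sym (<⇒≢ k<s))) (tagged-below (suc s) Ms (m<n⇒m<1+n k<s)))

  tagged-at : ∀ s (Ms : List (MidGate n)) (k : Fin (length Ms)) →
              sumBy (inputTo (s + toℕ k)) (tagged s Ms) ≡ ⟦ proj₂ (lookup Ms k) ⟧₅ x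
  tagged-at s ((_ , L) ∷ Ms) zero rewrite +-identityʳ s = trans (sumBy-++ _ (map (s ,_) L) _)
    (trans (cong₂ _+_ (inputTo-own s L) (tagged-below (suc s) Ms (n<1+n s))) (+-identityʳ _))
  tagged-at s ((_ , L) ∷ Ms) (suc k) = trans (sumBy-++ _ (map (s ,_) L) _)
    (cong₂ _+_ (inputTo-other s L (<⇒≢ (m<m+n s z<s))) (trans (cong (λ i → sumBy (inputTo i) (tagged (suc s) Ms)) (+-suc s (toℕ k)))
                                                            (tagged-at (suc s) Ms k)))

  topSum-circuit : (Ms : List (MidGate n)) → Circuit.topSum (circuit Ms) x ≡ sumBy (evalMid x) Ms
  topSum-circuit Ms = trans (sumFin-cong (λ k → cong (λ s → proj₁ (lookup Ms k) * b2n (modGate 6 s))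
                                                     (trans (sumFin-lookup (inputTo (toℕ k)) (tagged 0 Ms)) (tagged-at 0 Ms k))))
                            (sumFin-lookup (evalMid x) Ms)

length-tagged : ∀ s (Ms : List (MidGate n)) → length (tagged s Ms) ≡ sumBy (length ∘ proj₂) Ms
length-tagged s []             = refl
length-tagged s ((_ , L) ∷ Ms) =
  trans (length-++ (map (s ,_) L)) (cong₂ _+_ (length-map (s ,_) L) (length-tagged (suc s) Ms))

-- The circuit for a symmetric function

module Gates₂ = MonomialGates 2 (upTo 2) (mod-≡ refl) normaliser₂
module Gates₃ = MonomialGates 3 (upTo 3) (mod-≡ refl) normaliser₃

prime[3] : Prime 3
prime[3] = from-yes (prime? 3)

prime[5] : Prime 5
prime[5] = from-yes (prime? 5)

-- F t is the value of the function on inputs of weight t.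
module Construction (n : ℕ) (F : ℕ → Bool) (e₂ e₃ e₅ : ℕ) where

  module P₂ = PrimePower prime[2] e₂
  module P₃ = PrimePower prime[3] e₃
  module P₅ = PrimePower prime[5] e₅

  -- the output gate sums to 0 mod 5 exactly when F holds
  outWeight : ℕ → ℕ
  outWeight t = if F t then 0 else 1

  -- the term c · x^T of the mod-5 indicator of t, multiplied by the mod-2 and mod-3 indicators of t
  midGate : ℕ → ℕ × List (Fin n) → MidGate n
  midGate t (c , T) = outWeight t * c , andGates (Gates₂.polyGates T (P₂.indicatorPoly n t))
                                                 (Gates₃.polyGates [] (P₃.indicatorPoly n t))

  midGates : ℕ → List (MidGate n)
  midGates t = map (midGate t) (P₅.indicatorPoly n t)

  symmetricCircuit : Circuit n
  symmetricCircuit = circuit (concatMap midGates (upTo (suc n)))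

  agrees : ℕ → ℕ → Bool
  agrees t w = (P₂.congruent t w ∧ P₃.congruent t w) ∧ P₅.congruent t w

  module _ (x : Fin n → Bool) where

    private
      w : ℕ
      w = weight x

    factor₂₃ : ℕ → ℕ
    factor₂₃ t = outWeight t * b2n (P₂.congruent t w ∧ P₃.congruent t w)

    evalMid-midGate : ∀ t cT → evalMid x (midGate t cT) ≡ factor₂₃ t * evalTerm x cT
    evalMid-midGate t (c , T) = begin
      outWeight t * c * b2n (modGate 6 (⟦ andGates mod₂ mod₃ ⟧₅ x))
        ≡⟨ cong (outWeight t * c *_) (andGates-correct mod₂ mod₃ x (monomial T x ∧ c₂) c₃ mod₂≡ mod₃≡) ⟩
      outWeight t * c * b2n ((monomial T x ∧ c₂) ∧ c₃)
        ≡⟨ cong (λ b → outWeight t * c * b2n b) (∧-assoc (monomial T x) c₂ c₃) ⟩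
      outWeight t * c * b2n (monomial T x ∧ (c₂ ∧ c₃))
        ≡⟨ cong (outWeight t * c *_) (b2n-∧ (monomial T x) (c₂ ∧ c₃)) ⟩
      outWeight t * c * (b2n (monomial T x) * b2n (c₂ ∧ c₃))
        ≡⟨ rearrange (outWeight t) c (b2n (monomial T x)) (b2n (c₂ ∧ c₃)) ⟩
      outWeight t * b2n (c₂ ∧ c₃) * (c * b2n (monomial T x))
        ∎
      where
      open ≡-Reasoning
      c₂ c₃ : Bool
      c₂ = P₂.congruent t w
      c₃ = P₃.congruent t w
      mod₂ mod₃ : GateSum n
      mod₂ = Gates₂.polyGates T (P₂.indicatorPoly n t)
      mod₃ = Gates₃.polyGates [] (P₃.indicatorPoly n t)
      mod₂≡ : ⟦ mod₂ ⟧₅ x ≡ b2n (monomial T x ∧ c₂) [mod 2 ]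
      mod₂≡ = ≡-mod-trans (Gates₂.⟦polyGates⟧₅ T (P₂.indicatorPoly n t) x)
        (≡-mod-trans (*-congˡ-mod (b2n (monomial T x)) (P₂.⟦indicatorPoly⟧ t x))
                     (≡⇒≡-mod (sym (b2n-∧ (monomial T x) c₂))))
      mod₃≡ : ⟦ mod₃ ⟧₅ x ≡ b2n c₃ [mod 3 ]
      mod₃≡ = ≡-mod-trans (Gates₃.⟦polyGates⟧₅ [] (P₃.indicatorPoly n t) x)
        (≡-mod-trans (≡⇒≡-mod (*-identityˡ _)) (P₃.⟦indicatorPoly⟧ t x))
      rearrange : ∀ o c m k → o * c * (m * k) ≡ o * k * (c * m)
      rearrange = solve-∀

    ⟦midGates⟧ : ∀ t → sumBy (evalMid x) (midGates t) ≡ factor₂₃ t * ⟦ P₅.indicatorPoly n t ⟧ x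
    ⟦midGates⟧ t = trans (sumBy-map (evalMid x) (midGate t) (P₅.indicatorPoly n t))
      (trans (sumBy-cong (P₅.indicatorPoly n t) (evalMid-midGate t)) (sumBy-*ˡ (factor₂₃ t) (evalTerm x) (P₅.indicatorPoly n t)))

    topSum-agrees : Circuit.topSum symmetricCircuit x ≡ sumBy (λ t → outWeight t * b2n (agrees t w)) (upTo (suc n)) [mod 5 ]
    topSum-agrees = begin
      Circuit.topSum symmetricCircuit x                             ≡⟨ topSum-circuit x (concatMap midGates ts) ⟩
      sumBy (evalMid x) (concatMap midGates ts)                     ≡⟨ sumBy-concatMap (evalMid x) midGates ts ⟩
      sumBy (λ t → sumBy (evalMid x) (midGates t)) ts               ≡⟨ sumBy-cong ts ⟦midGates⟧ ⟩
      sumBy (λ t → factor₂₃ t * ⟦ P₅.indicatorPoly n t ⟧ x) ts     ≈⟨ sumBy-cong-mod ts (λ t → *-congˡ-mod (factor₂₃ t) (P₅.⟦indicatorPoly⟧ t x)) ⟩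
      sumBy (λ t → factor₂₃ t * b2n (P₅.congruent t w)) ts         ≡⟨ sumBy-cong ts (λ t → trans (*-assoc (outWeight t) _ _)
                                                                        (cong (outWeight t *_) (sym (b2n-∧ _ (P₅.congruent t w))))) ⟩
      sumBy (λ t → outWeight t * b2n (agrees t w)) ts               ∎
      where
      open ≡-mod-Reasoning {5}
      ts : List ℕ
      ts = upTo (suc n)

  module _ (n<M : n < 2 ^ e₂ * 3 ^ e₃ * 5 ^ e₅) where

    private instance
      q₂≢0 : NonZero (2 ^ e₂)
      q₂≢0 = m^n≢0 2 e₂
      q₃≢0 : NonZero (3 ^ e₃)
      q₃≢0 = m^n≢0 3 e₃
      q₅≢0 : NonZero (5 ^ e₅)
      q₅≢0 = m^n≢0 5 e₅
      q₂q₃≢0 : NonZero (2 ^ e₂ * 3 ^ e₃)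
      q₂q₃≢0 = m*n≢0 (2 ^ e₂) (3 ^ e₃)
      M≢0 : NonZero (2 ^ e₂ * 3 ^ e₃ * 5 ^ e₅)
      M≢0 = m*n≢0 (2 ^ e₂ * 3 ^ e₃) (5 ^ e₅)

    q₂⊥q₃ : Coprime (2 ^ e₂) (3 ^ e₃)
    q₂⊥q₃ = coprime-^ (from-yes (coprime? 2 3)) e₂ e₃

    q₂q₃⊥q₅ : Coprime (2 ^ e₂ * 3 ^ e₃) (5 ^ e₅)
    q₂q₃⊥q₅ = Coprime.sym (coprime-*ʳ (coprime-^ (from-yes (coprime? 5 2)) e₅ e₂) (coprime-^ (from-yes (coprime? 5 3)) e₅ e₃))

    agrees⇒≡ : ∀ t w → t ≤ n → w ≤ n → agrees t w ≡ true → w ≡ t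
    agrees⇒≡ t w t≤n w≤n agree
      with P₂.congruent t w in c₂ | P₃.congruent t w in c₃ | P₅.congruent t w in c₅ | agree
    ... | true | true | true | _ = <-≡-mod⇒≡ (≤-<-trans w≤n n<M) (≤-<-trans t≤n n<M)
      (coprime-≡-mod q₂q₃⊥q₅ (coprime-≡-mod q₂⊥q₃ (mod-≡ (≡ᵇ-true⇒≡ c₂)) (mod-≡ (≡ᵇ-true⇒≡ c₃))) (mod-≡ (≡ᵇ-true⇒≡ c₅)))

    agrees-refl : ∀ w → agrees w w ≡ true
    agrees-refl w rewrite ≡ᵇ-refl (w % 2 ^ e₂) | ≡ᵇ-refl (w % 3 ^ e₃) | ≡ᵇ-refl (w % 5 ^ e₅) = refl

    topSum-outWeight : (x : Fin n → Bool) → Circuit.topSum symmetricCircuit x ≡ outWeight (weight x) [mod 5 ]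
    topSum-outWeight x = ≡-mod-trans (topSum-agrees x) (≡⇒≡-mod (begin
      sumBy (λ t → outWeight t * b2n (agrees t w)) (upTo (suc n))  ≡⟨ sumBy-upTo-single (suc n) (s≤s (weight≤n x)) others ⟩
      outWeight w * b2n (agrees w w)                               ≡⟨ cong (λ b → outWeight w * b2n b) (agrees-refl w) ⟩
      outWeight w * 1                                              ≡⟨ *-identityʳ (outWeight w) ⟩
      outWeight w                                                  ∎))
      where
      open ≡-Reasoning
      w : ℕ
      w = weight x
      others : ∀ t → t < suc n → t ≢ w → outWeight t * b2n (agrees t w) ≡ 0
      others t t<1+n t≢w with agrees t w in agree
      ... | true  = contradiction (sym (agrees⇒≡ t w (s≤s⁻¹ t<1+n) (weight≤n x) agree)) t≢w
      ... | false = *-zeroʳ (outWeight t)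

    symmetricCircuit-correct : (x : Fin n → Bool) →
      Circuit.eval symmetricCircuit x ≡ F (weight x) ×
      (Circuit.topSum symmetricCircuit x % 5 ≡ 0 ⊎ Circuit.topSum symmetricCircuit x % 5 ≡ 1)
    symmetricCircuit-correct x = mod₅-output (Circuit.topSum symmetricCircuit x) (F (weight x)) (topSum-outWeight x)

  polyBound : ℕ → ℕ
  polyBound Q = Q * suc n ^ Q

  midBound : ℕ → ℕ
  midBound Q = polyBound Q * (2 * 2 ^ (Q + Q)) + (polyBound Q * (3 * 3 ^ Q) + 2)

  module _ (Q : ℕ) (q₂≤Q : 2 ^ e₂ ≤ Q) (q₃≤Q : 3 ^ e₃ ≤ Q) (q₅≤Q : 5 ^ e₅ ≤ Q) where

    private
      N : ℕ
      N = suc n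

    indicatorPoly-length≤ : ∀ {q} (P : Poly n) → length P ≤ q * N ^ q → q ≤ Q → length P ≤ polyBound Q
    indicatorPoly-length≤ P |P|≤ q≤Q = ≤-trans |P|≤ (*-mono-≤ q≤Q (^-monoʳ-≤ N q≤Q))

    midGate-length : ∀ t (cT : ℕ × List (Fin n)) → length (proj₂ cT) < 5 ^ e₅ → length (proj₂ (midGate t cT)) ≤ midBound Q
    midGate-length t (c , T) |T|<q₅ = begin
      length (scaleGates 3 L ++ scaleGates 2 M ++ (3 , 0ᶠ) ∷ (4 , 0ᶠ) ∷ [])
        ≡⟨ trans (length-++ (scaleGates 3 L)) (cong₂ _+_ (length-map _ L) (trans (length-++ (scaleGates 2 M)) (cong (_+ 2) (length-map _ M)))) ⟩
      length L + (length M + 2)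
        ≤⟨ +-mono-≤ (≤-trans (Gates₂.polyGates-length (s≤s z≤n) (2 ^ e₂) T I₂ (P₂.indicatorPoly-degree n t))
                             (*-mono-≤ (indicatorPoly-length≤ I₂ (P₂.indicatorPoly-length n t) q₂≤Q)
                                       (*-monoʳ-≤ 2 (^-monoʳ-≤ 2 (+-mono-≤ (<⇒≤ (<-≤-trans |T|<q₅ q₅≤Q)) q₂≤Q)))))
                    (+-monoˡ-≤ 2 (≤-trans (Gates₃.polyGates-length (s≤s z≤n) (3 ^ e₃) [] I₃ (P₃.indicatorPoly-degree n t))
                             (*-mono-≤ (indicatorPoly-length≤ I₃ (P₃.indicatorPoly-length n t) q₃≤Q)
                                       (*-monoʳ-≤ 3 (^-monoʳ-≤ 3 q₃≤Q))))) ⟩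
      midBound Q
        ∎
      where
      open ≤-Reasoning
      I₂ I₃ : Poly n
      I₂ = P₂.indicatorPoly n t
      I₃ = P₃.indicatorPoly n t
      L M : GateSum n
      L = Gates₂.polyGates T I₂
      M = Gates₃.polyGates [] I₃

    size-bound : Circuit.size symmetricCircuit ≤ 1 + N * polyBound Q + N * (polyBound Q * midBound Q)
    size-bound = +-mono-≤ (+-monoʳ-≤ 1 mids) bots
      where
      open ≤-Reasoning
      Ms : List (MidGate n)
      Ms = concatMap midGates (upTo N)
      P₅ : ℕ → Poly n
      P₅ t = P₅.indicatorPoly n t
      mids : length Ms ≤ N * polyBound Q
      mids = begin
        length Ms                            ≡⟨ length-concatMap midGates (upTo N) ⟩
        sumBy (length ∘ midGates) (upTo N)   ≤⟨ sumBy-≤ (All.universal midGates-length (upTo N)) ⟩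
        length (upTo N) * polyBound Q        ≡⟨ cong (_* polyBound Q) (length-upTo N) ⟩
        N * polyBound Q                      ∎
        where
        midGates-length : ∀ t → length (midGates t) ≤ polyBound Q
        midGates-length t = ≤-trans (≤-reflexive (length-map _ (P₅ t)))
                                    (indicatorPoly-length≤ (P₅ t) (P₅.indicatorPoly-length n t) q₅≤Q)
      bottoms : ∀ t → sumBy (length ∘ proj₂) (midGates t) ≤ polyBound Q * midBound Q
      bottoms t = begin
        sumBy (length ∘ proj₂) (midGates t)         ≡⟨ sumBy-map (length ∘ proj₂) (midGate t) (P₅ t) ⟩
        sumBy (length ∘ proj₂ ∘ midGate t) (P₅ t)   ≤⟨ sumBy-≤ (All.map (λ {cT} → midGate-length t cT) (P₅.indicatorPoly-degree n t)) ⟩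
        length (P₅ t) * midBound Q                  ≤⟨ *-monoˡ-≤ (midBound Q) (indicatorPoly-length≤ (P₅ t) (P₅.indicatorPoly-length n t) q₅≤Q) ⟩
        polyBound Q * midBound Q                    ∎
      bots : length (tagged 0 Ms) ≤ N * (polyBound Q * midBound Q)
      bots = begin
        length (tagged 0 Ms)                                         ≡⟨ length-tagged 0 Ms ⟩
        sumBy (length ∘ proj₂) Ms                                    ≡⟨ sumBy-concatMap (length ∘ proj₂) midGates (upTo N) ⟩
        sumBy (λ t → sumBy (length ∘ proj₂) (midGates t)) (upTo N)   ≤⟨ sumBy-≤ (All.universal bottoms (upTo N)) ⟩
        length (upTo N) * (polyBound Q * midBound Q)                 ≡⟨ cong (_* (polyBound Q * midBound Q)) (length-upTo N) ⟩
        N * (polyBound Q * midBound Q)                               ∎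

-- Size arithmetic

n≤m^n : ∀ {m} → 2 ≤ m → ∀ n → n ≤ m ^ n
n≤m^n {m} 2≤m zero    = z≤n
n≤m^n {m} 2≤m (suc n) = begin
  suc n              ≤⟨ +-mono-≤ (m^n>0 m {{>-nonZero (<-≤-trans z<s 2≤m)}} n) (n≤m^n 2≤m n) ⟩
  m ^ n + m ^ n      ≡⟨ cong (m ^ n +_) (+-identityʳ (m ^ n)) ⟨
  2 * m ^ n          ≤⟨ *-monoˡ-≤ (m ^ n) 2≤m ⟩
  m * m ^ n          ∎
  where open ≤-Reasoning

module PowerBounds {R : ℕ} (2≤R : 2 ≤ R) where

  private instance
    R≢0 : NonZero R
    R≢0 = >-nonZero (<-≤-trans z<s 2≤R)

  ≤^-* : ∀ {a b} i j → a ≤ R ^ i → b ≤ R ^ j → a * b ≤ R ^ (i + j)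
  ≤^-* i j a≤ b≤ = ≤-trans (*-mono-≤ a≤ b≤) (≤-reflexive (sym (^-distribˡ-+-* R i j)))

  ≤^-+ : ∀ {a b} i → a ≤ R ^ i → b ≤ R ^ i → a + b ≤ R ^ suc i
  ≤^-+ {a} {b} i a≤ b≤ = begin
    a + b              ≤⟨ +-mono-≤ a≤ b≤ ⟩
    R ^ i + R ^ i      ≡⟨ cong (R ^ i +_) (+-identityʳ (R ^ i)) ⟨
    2 * R ^ i          ≤⟨ *-monoˡ-≤ (R ^ i) 2≤R ⟩
    R ^ suc i          ∎
    where open ≤-Reasoning

  ≤^-weaken : ∀ {a} i j → a ≤ R ^ i → i ≤ j → a ≤ R ^ j
  ≤^-weaken i j a≤ i≤j = ≤-trans a≤ (^-monoʳ-≤ R i≤j)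

  ≤^1 : ∀ {a} → a ≤ R → a ≤ R ^ 1
  ≤^1 a≤R = ≤-trans a≤R (≤-reflexive (sym (*-identityʳ R)))

size-arithmetic : ∀ m Q → 3 ≤ m → 1 ≤ Q →
  1 + m * (Q * m ^ Q) + m * (Q * m ^ Q * (Q * m ^ Q * (2 * 2 ^ (Q + Q)) + (Q * m ^ Q * (3 * 3 ^ Q) + 2)))
    ≤ (m ^ Q) ^ 10
size-arithmetic m Q 3≤m 1≤Q =
  ≤^-+ 9 (≤^-weaken 4 9 (≤^-+ 3 (one 3) (≤^-* 1 2 m≤R^1 poly)) (m≤m+n 4 5)) (≤^-* 1 8 m≤R^1 (≤^-* 2 6 poly mid))
  where
  instance
    m≢0 : NonZero m
    m≢0 = >-nonZero (<-≤-trans z<s 3≤m)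
  R : ℕ
  R = m ^ Q
  2≤m : 2 ≤ m
  2≤m = ≤-trans (n≤1+n 2) 3≤m
  m≤R : m ≤ R
  m≤R = ≤-trans (≤-reflexive (sym (*-identityʳ m))) (^-monoʳ-≤ m 1≤Q)
  open PowerBounds {R} (≤-trans 2≤m m≤R)
  one : ∀ i → 1 ≤ R ^ i
  one i = m^n>0 R {{m^n≢0 m Q}} i
  ≤m⇒≤R^1 : ∀ {a} → a ≤ m → a ≤ R ^ 1
  ≤m⇒≤R^1 a≤m = ≤^1 (≤-trans a≤m m≤R)
  m≤R^1 : m ≤ R ^ 1
  m≤R^1 = ≤^1 m≤R
  poly : Q * m ^ Q ≤ R ^ 2
  poly = ≤^-* 1 1 (≤^1 (n≤m^n 2≤m Q)) (≤^1 ≤-refl)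
  2^[Q+Q]≤ : 2 ^ (Q + Q) ≤ R ^ 2
  2^[Q+Q]≤ = subst (_≤ R ^ 2) (sym (^-distribˡ-+-* 2 Q Q)) (≤^-* 1 1 (≤^1 (^-monoˡ-≤ Q 2≤m)) (≤^1 (^-monoˡ-≤ Q 2≤m)))
  mid : Q * m ^ Q * (2 * 2 ^ (Q + Q)) + (Q * m ^ Q * (3 * 3 ^ Q) + 2) ≤ R ^ 6
  mid = ≤^-+ 5 (≤^-* 2 3 poly (≤^-* 1 2 (≤m⇒≤R^1 2≤m) 2^[Q+Q]≤))
               (≤^-+ 4 (≤^-* 2 2 poly (≤^-* 1 1 (≤m⇒≤R^1 3≤m) (≤^1 (^-monoˡ-≤ Q 3≤m)))) (≤^-weaken 1 4 (≤m⇒≤R^1 2≤m) (m≤m+n 1 3)))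

cubeRoot : ℕ → ℕ
cubeRoot zero    = 0
cubeRoot (suc n) with suc n ≤? cubeRoot n ^ 3
... | yes _ = cubeRoot n
... | no  _ = suc (cubeRoot n)

cubeRoot-spec : ∀ n → n ≤ cubeRoot n ^ 3 × (∀ k → n ≤ k ^ 3 → cubeRoot n ≤ k)
cubeRoot-spec zero = z≤n , λ _ _ → z≤n
cubeRoot-spec (suc n) with suc n ≤? cubeRoot n ^ 3 | cubeRoot-spec n
... | yes 1+n≤c³ | _ , least = 1+n≤c³ , λ k 1+n≤k³ → least k (≤-trans (n≤1+n n) 1+n≤k³)
... | no  1+n≰c³ | n≤c³ , _  = ≤-trans (s≤s n≤c³) (^-monoˡ-< 3 (n<1+n c)) , least
  where
  c : ℕ
  c = cubeRoot n
  least : ∀ k → suc n ≤ k ^ 3 → suc c ≤ k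
  least k 1+n≤k³ with suc c ≤? k
  ... | yes 1+c≤k = 1+c≤k
  ... | no  1+c≰k = contradiction (≤-trans (^-monoˡ-≤ 3 (≤-pred (≰⇒> 1+c≰k))) (≤-pred (≰⇒> 1+n≰c³)))
                                  (<⇒≱ 1+n≤k³)

logAbove : ℕ → ℕ → ℕ
logAbove p zero    = 0
logAbove p (suc m) with suc m <? p ^ logAbove p m
... | yes _ = logAbove p m
... | no  _ = suc (logAbove p m)

logAbove-spec : ∀ {p} → 2 ≤ p → ∀ m → m < p ^ logAbove p m × p ^ logAbove p m ≤ p * suc m
logAbove-spec {p} 2≤p zero = z<s , ≤-trans (<-≤-trans z<s 2≤p) (≤-reflexive (sym (*-identityʳ p)))
logAbove-spec {p} 2≤p (suc m) with suc m <? p ^ logAbove p m | logAbove-spec 2≤p m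
... | yes 1+m<pᵉ | _ , pᵉ≤p[1+m] = 1+m<pᵉ , ≤-trans pᵉ≤p[1+m] (*-monoʳ-≤ p (n≤1+n (suc m)))
... | no  1+m≮pᵉ | m<pᵉ , _ = <-≤-trans 1+m<p[1+m] (≤-reflexive (sym pᵉ⁺¹≡)) , ≤-trans (≤-reflexive pᵉ⁺¹≡) (*-monoʳ-≤ p (n≤1+n (suc m)))
  where
  pᵉ⁺¹≡ : p ^ suc (logAbove p m) ≡ p * suc m
  pᵉ⁺¹≡ = cong (p *_) (≤-antisym (≮⇒≥ 1+m≮pᵉ) m<pᵉ)
  1+m<p[1+m] : suc m < p * suc m
  1+m<p[1+m] = <-≤-trans (m<m+n (suc m) {suc m + 0} z<s) (*-monoˡ-≤ (suc m) 2≤p)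

ones : ∀ n → ℕ → Fin n → Bool
ones n w i = toℕ i <ᵇ w

weight-ones : ∀ n w → w ≤ n → weight (ones n w) ≡ w
weight-ones zero    zero    _         = refl
weight-ones (suc n) zero    _         = weight-ones n zero z≤n
weight-ones (suc n) (suc w) (s≤s w≤n) = cong suc (weight-ones n w w≤n)

1+n≤n² : 2 ≤ n → suc n ≤ n ^ 2
1+n≤n² {n} 2≤n = begin
  1 + n       ≤⟨ +-monoˡ-≤ n (≤-trans (n≤1+n 1) 2≤n) ⟩
  n + n       ≡⟨ cong (n +_) (+-identityʳ n) ⟨
  2 * n       ≤⟨ *-monoˡ-≤ n 2≤n ⟩
  n * n       ≡⟨ cong (n *_) (*-identityʳ n) ⟨
  n ^ 2       ∎
  where open ≤-Reasoning

module Parameters (n : ℕ) (2≤n : 2 ≤ n) where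

  k₀ e₂ e₃ e₅ Q : ℕ
  k₀ = cubeRoot n
  e₂ = logAbove 2 k₀
  e₃ = logAbove 3 k₀
  e₅ = logAbove 5 k₀
  Q  = 5 * suc k₀

  private
    spec₂ : k₀ < 2 ^ e₂ × 2 ^ e₂ ≤ 2 * suc k₀
    spec₂ = logAbove-spec {2} ≤-refl k₀
    spec₃ : k₀ < 3 ^ e₃ × 3 ^ e₃ ≤ 3 * suc k₀
    spec₃ = logAbove-spec {3} (n≤1+n 2) k₀
    spec₅ : k₀ < 5 ^ e₅ × 5 ^ e₅ ≤ 5 * suc k₀
    spec₅ = logAbove-spec {5} (m≤m+n 2 3) k₀

  n<q₂q₃q₅ : n < 2 ^ e₂ * 3 ^ e₃ * 5 ^ e₅
  n<q₂q₃q₅ = begin-strict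
    n                               ≤⟨ proj₁ (cubeRoot-spec n) ⟩
    k₀ ^ 3                          <⟨ ^-monoˡ-< 3 (n<1+n k₀) ⟩
    suc k₀ ^ 3                      ≡⟨ cube (suc k₀) ⟩
    suc k₀ * suc k₀ * suc k₀        ≤⟨ *-mono-≤ (*-mono-≤ (proj₁ spec₂) (proj₁ spec₃)) (proj₁ spec₅) ⟩
    2 ^ e₂ * 3 ^ e₃ * 5 ^ e₅        ∎
    where
    open ≤-Reasoning
    cube : ∀ a → a ^ 3 ≡ a * a * a
    cube a = trans (cong (λ b → a * (a * b)) (*-identityʳ a)) (sym (*-assoc a a a))

  private
    q≤Q : ∀ {p} e → p ≤ 5 → p ^ e ≤ p * suc k₀ → p ^ e ≤ Q
    q≤Q e p≤5 pᵉ≤ = ≤-trans pᵉ≤ (*-monoˡ-≤ (suc k₀) p≤5)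

  q₂≤Q : 2 ^ e₂ ≤ Q
  q₂≤Q = q≤Q e₂ (m≤m+n 2 3) (proj₂ spec₂)

  q₃≤Q : 3 ^ e₃ ≤ Q
  q₃≤Q = q≤Q e₃ (m≤m+n 3 2) (proj₂ spec₃)

  q₅≤Q : 5 ^ e₅ ≤ Q
  q₅≤Q = q≤Q e₅ ≤-refl (proj₂ spec₅)

  1≤k₀ : 1 ≤ k₀
  1≤k₀ with k₀ | proj₁ (cubeRoot-spec n)
  ... | zero  | n≤0 = contradiction (≤-trans 2≤n n≤0) λ ()
  ... | suc _ | _   = s≤s z≤n

  Q≤10k₀ : Q ≤ 10 * k₀
  Q≤10k₀ with k₀ | 1≤k₀
  ... | suc j | _ = subst (5 * suc (suc j) ≤_) (split j) (m≤m+n (5 * suc (suc j)) (5 * j))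
    where
    split : ∀ j → 5 * suc (suc j) + 5 * j ≡ 10 * suc j
    split = solve-∀

  exponent≤ : ∀ k → n ≤ k ^ 3 → 2 * (Q * 10) ≤ 200 * k
  exponent≤ k n≤k³ = begin
    2 * (Q * 10)          ≤⟨ *-monoʳ-≤ 2 (*-monoˡ-≤ 10 (≤-trans Q≤10k₀ (*-monoʳ-≤ 10 (proj₂ (cubeRoot-spec n) k n≤k³)))) ⟩
    2 * (10 * k * 10)     ≡⟨ regroup k ⟩
    200 * k               ∎
    where
    open ≤-Reasoning
    regroup : ∀ k → 2 * (10 * k * 10) ≡ 200 * k
    regroup = solve-∀

symmetric-circuit : ∀ n → 2 ≤ n → (F : ℕ → Bool) →
  Σ (Circuit n) λ c →
    ((x : Fin n → Bool) → Circuit.eval c x ≡ F (weight x)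
                          × (Circuit.topSum c x % 5 ≡ 0 ⊎ Circuit.topSum c x % 5 ≡ 1))
    × ((k : ℕ) → n ≤ k ^ 3 → Circuit.size c ≤ n ^ (200 * k))
symmetric-circuit n 2≤n F = symmetricCircuit , symmetricCircuit-correct n<q₂q₃q₅ , size≤
  where
  open Parameters n 2≤n
  open Construction n F e₂ e₃ e₅
  size≤ : (k : ℕ) → n ≤ k ^ 3 → Circuit.size symmetricCircuit ≤ n ^ (200 * k)
  size≤ k n≤k³ = begin
    Circuit.size symmetricCircuit                                 ≤⟨ size-bound Q q₂≤Q q₃≤Q q₅≤Q ⟩
    1 + suc n * polyBound Q + suc n * (polyBound Q * midBound Q)  ≤⟨ size-arithmetic (suc n) Q (s≤s 2≤n) (s≤s z≤n) ⟩
    (suc n ^ Q) ^ 10                                              ≡⟨ ^-*-assoc (suc n) Q 10 ⟩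
    suc n ^ (Q * 10)                                              ≤⟨ ^-monoˡ-≤ (Q * 10) (1+n≤n² 2≤n) ⟩
    (n ^ 2) ^ (Q * 10)                                            ≡⟨ ^-*-assoc n 2 (Q * 10) ⟩
    n ^ (2 * (Q * 10))                                            ≤⟨ ^-monoʳ-≤ n {{>-nonZero (<-≤-trans z<s 2≤n)}} (exponent≤ k n≤k³) ⟩
    n ^ (200 * k)                                                 ∎
    where open ≤-Reasoning

theorem3p1 : Σ ℕ λ C → Σ ℕ λ N₀ → (n : ℕ) → N₀ ≤ n →
    (f : (Fin n → Bool) → Bool) → Symmetric f →
    Σ (Circuit n) λ c →
      ((x : Fin n → Bool) → Circuit.eval c x ≡ f x)
      × ((x : Fin n → Bool) → (Circuit.topSum c x % 5 ≡ 0) ⊎ (Circuit.topSum c x % 5 ≡ 1))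
      × ((k : ℕ) → n ≤ k ^ 3 → Circuit.size c ≤ n ^ (C * k))
theorem3p1 = 200 , 2 , λ n 2≤n f f-symmetric →
  let c , correct , size≤ = symmetric-circuit n 2≤n (f ∘ ones n)
      f-weight x = f-symmetric (ones n (weight x)) x (weight-ones n (weight x) (weight≤n x))
  in c , (λ x → trans (proj₁ (correct x)) (f-weight x)) , proj₂ ∘ correct , size≤
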